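{- Let $p\ge 7$ be a prime and let $N,R,n,r$ be non-negative integers with $N\ge R$ and $n<p$, $r<p$. (a) If $r\le n$, then, as a congruence of $p$-integral rational numbers, $$\binom{Np^3+n}{Rp^3+r}\Big/\Big[\binom{N}{R}\binom{n}{r}\Big]\equiv 1+c(N,R,n,r;p)\,p^3\pmod{p^5},$$ where $c(N,R,n,r;p)=H_1(n)N-H_1(r)R+\big(w_pNR-H_1(n-r)\big)(N-R)$. (b) If $n<r$, then $$\binom{Np^3+n}{Rp^3+r}\Big/\binom{N}{R}\equiv (-1)^{r-n+1}\,\frac{N-R}{r}\,\binom{r-1}{n}^{ -1}p^3\pmod{p^5}.$$
   Context: For a non-negative integer $m$, $H_1(m)=\sum_{k=1}^{m}\frac1k$ (with $H_1(0)=0$); for $m<p$ this is $p$-integral. For a prime $p\ge5$, Wolstenholme's theorem gives $H_1(p-1)\equiv0\pmod{p^2}$, and $w_p$ denotes the unique integer with $0\le w_p<p^2$ and $w_p\equiv H_1(p-1)/p^2\pmod{p^2}$. -}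

module Defs where

open import Data.Nat using (ℕ; zero; suc; _^_)
open import Data.Nat.Divisibility using (_∣_)
open import Data.Integer using (ℤ; +_)
open import Data.Rational using (ℚ; _/_; _+_; _-_; _*_; -_; 0ℚ; 1ℚ; ↧ₙ_)
open import Data.Product using (Σ; _×_)
open import Relation.Binary.PropositionalEquality using (_≡_)
open import Relation.Nullary using (¬_)

ℕtoℚ : ℕ → ℚ
ℕtoℚ a = (+ a) / 1

-- a / b as a rational, for natural numbers a, b; junk value 0 when b = 0
-- (only ever used with b ≠ 0 guaranteed by the hypotheses)
_÷ℕ_ : ℕ → ℕ → ℚ
a ÷ℕ zero = 0ℚ
a ÷ℕ suc b = (+ a) / suc b

sgn : ℕ → ℚ
sgn zero = 1ℚ
sgn (suc k) = - sgn k

H1 : ℕ → ℚ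
H1 zero = 0ℚ
H1 (suc m) = H1 m + (1 ÷ℕ suc m)

pIntegral : ℕ → ℚ → Set
pIntegral p q = ¬ (p ∣ ↧ₙ q)

CongModPow : ℕ → ℕ → ℚ → ℚ → Set
CongModPow p k x y = Σ ℚ (λ z → pIntegral p z × (x - y ≡ z * ℕtoℚ (p ^ k)))

module Submission where

-- Write p = q + 1 and F(a) = (ap + 1)(ap + 2)⋯(ap + q), so F(a) = ∑ₖ cₖ (ap)ᵏ with cₖ the
-- coefficients of (X + 1)⋯(X + q); here c₀ = q!, c₁ = q! H₁(q), and p ∣ cₖ for 1 ≤ k ≤ p - 2.
-- As q is even, F(-a-1) = F(a); comparing F(-1) = F(0) and F(1) = F(-2) modulo p⁵ removes the
-- p² and p³ terms, and Wolstenholme's quotient then gives F(a) ≡ q! (1 + a(a+1) w p³) (mod p⁵).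
-- Since (Mp)! = pᴹ M! ∏_{m<M} F(m), the binomial C(Np³, Rp³) factors through the three p-adic
-- levels as C(N, R) times ratios of such products, and ∑_{m<K} [(D+m)(D+m+1) - m(m+1)] = DK(D+K)
-- shows that only the lowest level contributes, a factor 1 + w p³ (N-R) R N modulo p⁵.  The
-- residues n and r enter through the products (x + 1)⋯(x + k) with p³ ∣ x, which are
-- k! + x·k! H₁(k) modulo x²; in case (b) one of these products contains the factor (N-R) p³ itself.

open import Data.Nat as ℕ using (ℕ; zero; suc; _≤_; _<_; z≤n; s≤s; NonZero; _!)
import Data.Nat.Properties as ℕₚ
import Data.Nat.Tactic.RingSolver as ℕ-Solver
open import Data.Nat.Divisibility using (_∣_; divides; ∣⇒≤; ∣-trans; ∣m+n∣m⇒∣n)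
open import Data.Nat.Primality using (Prime; euclidsLemma; prime⇒nonZero; prime⇒nonTrivial; prime⇒irreducible)
open import Data.Nat.Combinatorics using (_C_; nCk≡n!/k![n-k]!; k![n∸k]!∣n!; k>n⇒nCk≡0)
open import Data.Nat.DivMod using (m/n*n≡m)
open import Data.Nat.Induction using (<-rec)
open import Data.Nat.GCD using (gcd)
open import Data.Integer as ℤ using (ℤ; +_; ∣_∣)
import Data.Integer.Properties as ℤₚ
open import Data.Integer.Tactic.RingSolver using (solve-∀; solve)
open import Data.Rational as ℚ using (ℚ; _/_; ↥_; ↧_; ↧ₙ_)
import Data.Rational.Properties as ℚₚ
open import Data.Rational.Unnormalised using (mkℚᵘ; *≡*) renaming (_≃_ to _≃ᵘ_)
import Data.Rational.Unnormalised.Properties as ℚᵘₚ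
open import Data.List using (_∷_; [])
open import Data.Product using (∃; _×_; _,_; proj₁; proj₂)
open import Data.Sum using (_⊎_; inj₁; inj₂)
open import Data.Empty using (⊥-elim)
open import Relation.Nullary using (¬_; yes; no)
open import Relation.Binary.Bundles using (Setoid)
open import Relation.Binary.PropositionalEquality
open import Defs

module Congruence where
  open import Data.Integer using (_+_; _*_; -_; _-_; 0ℤ)

  infix 4 _≡_mod_
  record _≡_mod_ (a b m : ℤ) : Set where
    constructor _,_
    field
      quotient : ℤ
      equation : a ≡ b + quotient * m

  mod-refl : ∀ {m} a → a ≡ a mod m
  mod-refl {m} a = 0ℤ , solve (a ∷ m ∷ [])

  mod-reflexive : ∀ {m a b} → a ≡ b → a ≡ b mod m
  mod-reflexive {a = a} refl = mod-refl a

  mod-sym : ∀ {m a b} → a ≡ b mod m → b ≡ a mod m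
  mod-sym {m} {b = b} (k , refl) = - k , solve (b ∷ k ∷ m ∷ [])

  mod-trans : ∀ {m a b c} → a ≡ b mod m → b ≡ c mod m → a ≡ c mod m
  mod-trans {m} {c = c} (k , refl) (l , refl) = l + k , solve (c ∷ k ∷ l ∷ m ∷ [])

  mod-+ : ∀ {m a b c d} → a ≡ b mod m → c ≡ d mod m → a + c ≡ b + d mod m
  mod-+ {m} {b = b} {d = d} (k , refl) (l , refl) = k + l , solve (b ∷ d ∷ k ∷ l ∷ m ∷ [])

  mod-neg : ∀ {m a b} → a ≡ b mod m → - a ≡ - b mod m
  mod-neg {m} {b = b} (k , refl) = - k , solve (b ∷ k ∷ m ∷ [])

  mod-- : ∀ {m a b c d} → a ≡ b mod m → c ≡ d mod m → a - c ≡ b - d mod m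
  mod-- a≡b c≡d = mod-+ a≡b (mod-neg c≡d)

  mod-* : ∀ {m a b c d} → a ≡ b mod m → c ≡ d mod m → a * c ≡ b * d mod m
  mod-* {m} {b = b} {d = d} (k , refl) (l , refl) =
    b * l + k * d + k * l * m , solve (b ∷ d ∷ k ∷ l ∷ m ∷ [])

  mod-*ˡ : ∀ {m a b} c → a ≡ b mod m → c * a ≡ c * b mod m
  mod-*ˡ c = mod-* (mod-refl c)

  mod-*ʳ : ∀ {m a b} c → a ≡ b mod m → a * c ≡ b * c mod m
  mod-*ʳ c a≡b = mod-* a≡b (mod-refl c)

  mod-scale : ∀ {m a b} c → a ≡ b mod m → c * a ≡ c * b mod c * m
  mod-scale {m} {b = b} c (k , refl) = k , solve (b ∷ c ∷ k ∷ m ∷ [])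

  mod-divisor : ∀ {m n a b} t → n ≡ m * t → a ≡ b mod n → a ≡ b mod m
  mod-divisor {m} {b = b} t refl (k , refl) = k * t , solve (b ∷ k ∷ m ∷ t ∷ [])

  mod-multiple : ∀ {m} a k → a + k * m ≡ a mod m
  mod-multiple a k = k , refl

  mod-setoid : ℤ → Setoid _ _
  mod-setoid m = record
    { Carrier = ℤ
    ; _≈_ = λ a b → a ≡ b mod m
    ; isEquivalence = record { refl = mod-refl _ ; sym = mod-sym ; trans = mod-trans }
    }

  module mod-Reasoning (m : ℤ) where
    open import Relation.Binary.Reasoning.Setoid (mod-setoid m) public

module Fraction where
  open import Data.Integer using (_+_; _*_; -_)

  infix 4 _≐_÷_
  record _≐_÷_ (x : ℚ) (a b : ℤ) : Set where
    constructor fraction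
    field
      denominator-1 : ℕ
      denominator : b ≡ + suc denominator-1
      value : x ≡ a / suc denominator-1

  private
    normalise : (a : ℤ) (b : ℕ) → ℚ.toℚᵘ (a / suc b) ≃ᵘ mkℚᵘ a b
    normalise a b = ℚₚ.toℚᵘ-fromℚᵘ (mkℚᵘ a b)

  /-≡ : ∀ a b c d → a * + suc d ≡ c * + suc b → a / suc b ≡ c / suc d
  /-≡ a b c d eq = ℚₚ.fromℚᵘ-cong {mkℚᵘ a b} {mkℚᵘ c d} (*≡* eq)

  /-≡⁻¹ : ∀ a b c d → a / suc b ≡ c / suc d → a * + suc d ≡ c * + suc b
  /-≡⁻¹ a b c d eq with ℚᵘₚ.≃-trans (ℚᵘₚ.≃-sym (normalise a b))
                          (ℚᵘₚ.≃-trans (ℚₚ.toℚᵘ-cong eq) (normalise c d))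
  ... | *≡* e = e

  /-+ : ∀ a b c d → a / suc b ℚ.+ c / suc d ≡ (a * + suc d + c * + suc b) / (suc b ℕ.* suc d)
  /-+ a b c d = ℚₚ.toℚᵘ-injective (ℚᵘₚ.≃-trans (ℚₚ.toℚᵘ-homo-+ (a / suc b) (c / suc d))
    (ℚᵘₚ.≃-trans (ℚᵘₚ.+-cong (normalise a b) (normalise c d))
      (ℚᵘₚ.≃-sym (normalise (a * + suc d + c * + suc b) (ℕ.pred (suc b ℕ.* suc d))))))

  /-* : ∀ a b c d → (a / suc b) ℚ.* (c / suc d) ≡ (a * c) / (suc b ℕ.* suc d)
  /-* a b c d = ℚₚ.toℚᵘ-injective (ℚᵘₚ.≃-trans (ℚₚ.toℚᵘ-homo-* (a / suc b) (c / suc d))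
    (ℚᵘₚ.≃-trans (ℚᵘₚ.*-cong (normalise a b) (normalise c d))
      (ℚᵘₚ.≃-sym (normalise (a * c) (ℕ.pred (suc b ℕ.* suc d))))))

  /-neg : ∀ a b → ℚ.- (a / suc b) ≡ (- a) / suc b
  /-neg a b = ℚₚ.toℚᵘ-injective (ℚᵘₚ.≃-trans (ℚₚ.toℚᵘ-homo‿- (a / suc b))
    (ℚᵘₚ.≃-trans (ℚᵘₚ.-‿cong (normalise a b)) (ℚᵘₚ.≃-sym (normalise (- a) b))))

  ÷-+ : ∀ {x y a b c d} → x ≐ a ÷ b → y ≐ c ÷ d → x ℚ.+ y ≐ a * d + c * b ÷ b * d
  ÷-+ {a = a} {c = c} (fraction m refl refl) (fraction n refl refl) =
    fraction (n ℕ.+ m ℕ.* suc n) (sym (ℤₚ.pos-* (suc m) (suc n))) (/-+ a m c n)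

  ÷-* : ∀ {x y a b c d} → x ≐ a ÷ b → y ≐ c ÷ d → x ℚ.* y ≐ a * c ÷ b * d
  ÷-* {a = a} {c = c} (fraction m refl refl) (fraction n refl refl) =
    fraction (n ℕ.+ m ℕ.* suc n) (sym (ℤₚ.pos-* (suc m) (suc n))) (/-* a m c n)

  ÷-neg : ∀ {x a b} → x ≐ a ÷ b → ℚ.- x ≐ - a ÷ b
  ÷-neg {a = a} (fraction m refl refl) = fraction m refl (/-neg a m)

  ÷-- : ∀ {x y a b c d} → x ≐ a ÷ b → y ≐ c ÷ d → x ℚ.- y ≐ a * d + - c * b ÷ b * d
  ÷-- x≐ y≐ = ÷-+ x≐ (÷-neg y≐)

  ÷-ℕ : ∀ m → ℕtoℚ m ≐ + m ÷ + 1
  ÷-ℕ m = fraction 0 refl refl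

  ÷-÷ℕ : ∀ m {k} → 0 < k → m ÷ℕ k ≐ + m ÷ + k
  ÷-÷ℕ m {suc k} _ = fraction k refl refl

  ÷-/ : ∀ a k → a / suc k ≐ a ÷ + suc k
  ÷-/ a k = fraction k refl refl

  ÷-reduced : ∀ x → x ≐ ↥ x ÷ + ↧ₙ x
  ÷-reduced x@record{} = fraction _ refl (sym (ℚₚ.↥p/↧p≡p x))

  ÷-reshape : ∀ {x a a′ b b′} → x ≐ a ÷ b → a ≡ a′ → b ≡ b′ → x ≐ a′ ÷ b′
  ÷-reshape x≐ refl refl = x≐

  ÷-≡ : ∀ {x y a b c d} → x ≐ a ÷ b → y ≐ c ÷ d → a * d ≡ c * b → x ≡ y
  ÷-≡ {a = a} {c = c} (fraction m refl refl) (fraction n refl refl) = /-≡ a m c n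

  ÷-≡⁻¹ : ∀ {x y a b c d} → x ≐ a ÷ b → y ≐ c ÷ d → x ≡ y → a * d ≡ c * b
  ÷-≡⁻¹ {a = a} {c = c} (fraction m refl refl) (fraction n refl refl) = /-≡⁻¹ a m c n

  ↧ₙ-/-∣ : ∀ a b → ↧ₙ (a / suc b) ∣ suc b
  ↧ₙ-/-∣ a b = divides g (trans (sym (ℤₚ.+-injective (trans (ℤₚ.pos-* (↧ₙ (a / suc b)) g) (ℚₚ.↧-/ a (suc b)))))
                                (ℕₚ.*-comm (↧ₙ (a / suc b)) g))
    where
    g = gcd ∣ a ∣ (suc b)

  pIntegral-/ : ∀ {p} a b → ¬ p ∣ suc b → pIntegral p (a / suc b)
  pIntegral-/ a b p∤b p∣↧ = p∤b (∣-trans p∣↧ (↧ₙ-/-∣ a b))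

module BigOperators where
  open import Data.Integer using (_+_; _*_; 0ℤ; 1ℤ; _^_)
  open Congruence

  ∑< : ℕ → (ℕ → ℤ) → ℤ
  ∑< zero    g = 0ℤ
  ∑< (suc n) g = ∑< n g + g n

  syntax ∑< n (λ j → e) = ∑[ j < n ] e

  ∏< : ℕ → (ℕ → ℤ) → ℤ
  ∏< zero    g = 1ℤ
  ∏< (suc n) g = ∏< n g * g n

  syntax ∏< n (λ j → e) = ∏[ j < n ] e

  ∏<ℕ : ℕ → (ℕ → ℕ) → ℕ
  ∏<ℕ zero    g = 1
  ∏<ℕ (suc n) g = ∏<ℕ n g ℕ.* g n

  syntax ∏<ℕ n (λ j → e) = ∏ℕ[ j < n ] e

  ∑-shift : ∀ n g → ∑< (suc n) g ≡ g 0 + ∑[ j < n ] g (suc j)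
  ∑-shift zero    g = ℤₚ.+-comm 0ℤ (g 0)
  ∑-shift (suc n) g = trans (cong (_+ g (suc n)) (∑-shift n g)) (ℤₚ.+-assoc (g 0) _ _)

  ∑-split : ∀ m n g → ∑< (m ℕ.+ n) g ≡ ∑< m g + ∑[ j < n ] g (m ℕ.+ j)
  ∑-split m zero    g = trans (cong (λ k → ∑< k g) (ℕₚ.+-identityʳ m)) (sym (ℤₚ.+-identityʳ _))
  ∑-split m (suc n) g = trans (cong (λ k → ∑< k g) (ℕₚ.+-suc m n))
    (trans (cong (_+ g (m ℕ.+ n)) (∑-split m n g)) (ℤₚ.+-assoc (∑< m g) _ _))

  ∑-cong : ∀ n {f g} → (∀ j → j < n → f j ≡ g j) → ∑< n f ≡ ∑< n g
  ∑-cong zero    f≡g = refl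
  ∑-cong (suc n) f≡g = cong₂ _+_ (∑-cong n (λ j j<n → f≡g j (ℕₚ.m<n⇒m<1+n j<n))) (f≡g n ℕₚ.≤-refl)

  ∑-zero : ∀ n {g} → (∀ j → j < n → g j ≡ 0ℤ) → ∑< n g ≡ 0ℤ
  ∑-zero n g≡0 = trans (∑-cong n g≡0) (∑-0 n)
    where
    ∑-0 : ∀ n → ∑[ j < n ] 0ℤ ≡ 0ℤ
    ∑-0 zero    = refl
    ∑-0 (suc n) = cong (_+ 0ℤ) (∑-0 n)

  ∑-+ : ∀ n f g → ∑[ j < n ] (f j + g j) ≡ ∑< n f + ∑< n g
  ∑-+ zero    f g = refl
  ∑-+ (suc n) f g = trans (cong (_+ (f n + g n)) (∑-+ n f g)) (interchange (∑< n f) (∑< n g) (f n) (g n))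
    where
    interchange : ∀ a b c d → a + b + (c + d) ≡ a + c + (b + d)
    interchange = solve-∀

  ∑-*ˡ : ∀ n c g → ∑[ j < n ] (c * g j) ≡ c * ∑< n g
  ∑-*ˡ zero    c g = sym (ℤₚ.*-zeroʳ c)
  ∑-*ˡ (suc n) c g = trans (cong (_+ c * g n) (∑-*ˡ n c g)) (sym (ℤₚ.*-distribˡ-+ c (∑< n g) (g n)))

  ∑-mod : ∀ {m} n {f g} → (∀ j → j < n → f j ≡ g j mod m) → ∑< n f ≡ ∑< n g mod m
  ∑-mod zero    f≡g = mod-refl 0ℤ
  ∑-mod (suc n) f≡g = mod-+ (∑-mod n (λ j j<n → f≡g j (ℕₚ.m<n⇒m<1+n j<n))) (f≡g n ℕₚ.≤-refl)

  ∏-cong : ∀ n {f g} → (∀ j → f j ≡ g j) → ∏< n f ≡ ∏< n g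
  ∏-cong zero    f≡g = refl
  ∏-cong (suc n) f≡g = cong₂ _*_ (∏-cong n f≡g) (f≡g n)

  ∏-mod : ∀ {m} n {f g} → (∀ j → f j ≡ g j mod m) → ∏< n f ≡ ∏< n g mod m
  ∏-mod zero    f≡g = mod-refl 1ℤ
  ∏-mod (suc n) f≡g = mod-* (∏-mod n f≡g) (f≡g n)

  pos-∏ : ∀ n g → + ∏<ℕ n g ≡ ∏[ j < n ] (+ g j)
  pos-∏ zero    g = refl
  pos-∏ (suc n) g = trans (ℤₚ.pos-* (∏<ℕ n g) (g n)) (cong (_* + g n) (pos-∏ n g))

  pos-^ : ∀ m k → + (m ℕ.^ k) ≡ (+ m) ^ k
  pos-^ m zero    = refl
  pos-^ m (suc k) = trans (ℤₚ.pos-* m (m ℕ.^ k)) (cong (λ u → + m * u) (pos-^ m k))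

module RisingProduct where
  open import Data.Integer using (_+_; _*_; -_; 0ℤ; 1ℤ; _^_)
  open Congruence
  open BigOperators

  rising : ℤ → ℕ → ℤ
  rising x k = ∏[ i < k ] (x + + suc i)

  risingℕ : ℕ → ℕ → ℕ
  risingℕ x k = ∏ℕ[ i < k ] (x ℕ.+ suc i)

  pos-rising : ∀ x k → + risingℕ x k ≡ rising (+ x) k
  pos-rising x k = trans (pos-∏ k _) (∏-cong k (λ i → ℤₚ.pos-+ x (suc i)))

  rising-mod : ∀ {m x y} k → x ≡ y mod m → rising x k ≡ rising y k mod m
  rising-mod k x≡y = ∏-mod k (λ i → mod-+ x≡y (mod-refl (+ suc i)))

  -- risingCoeff m k is the coefficient of Xᵏ in (X + 1)(X + 2)⋯(X + m),
  -- the unsigned Stirling number of the first kind [m+1, k+1].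
  risingCoeff : ℕ → ℕ → ℤ
  risingCoeff zero    zero    = 1ℤ
  risingCoeff zero    (suc k) = 0ℤ
  risingCoeff (suc m) zero    = + suc m * risingCoeff m zero
  risingCoeff (suc m) (suc k) = risingCoeff m k + + suc m * risingCoeff m (suc k)

  risingCoeff-vanish : ∀ {m k} → m < k → risingCoeff m k ≡ 0ℤ
  risingCoeff-vanish {zero}  {suc k} _         = refl
  risingCoeff-vanish {suc m} {suc k} (s≤s m<k) =
    trans (cong₂ (λ u v → u + + suc m * v) (risingCoeff-vanish m<k) (risingCoeff-vanish (ℕₚ.m<n⇒m<1+n m<k)))
          (cong (λ u → 0ℤ + u) (ℤₚ.*-zeroʳ (+ suc m)))

  risingCoeff-diag : ∀ m → risingCoeff m m ≡ 1ℤ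
  risingCoeff-diag zero    = refl
  risingCoeff-diag (suc m) =
    trans (cong₂ (λ u v → u + + suc m * v) (risingCoeff-diag m) (risingCoeff-vanish (ℕₚ.n<1+n m)))
          (cong (λ u → 1ℤ + u) (ℤₚ.*-zeroʳ (+ suc m)))

  rising-expand : ∀ X m → rising X m ≡ ∑[ k < suc m ] (risingCoeff m k * X ^ k)
  rising-expand X zero    = refl
  rising-expand X (suc m) = sym (begin
      ∑[ k < suc (suc m) ] (c (suc m) k * X ^ k)
    ≡⟨ ∑-shift (suc m) _ ⟩
      c (suc m) 0 * 1ℤ + ∑[ j < suc m ] ((c m j + + suc m * c m (suc j)) * (X * X ^ j))
    ≡⟨ cong (λ u → c (suc m) 0 * 1ℤ + u) (∑-cong (suc m) (λ j _ → distribute (c m j) (c m (suc j)) (X ^ j) X (+ suc m))) ⟩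
      c (suc m) 0 * 1ℤ + ∑[ j < suc m ] (X * (c m j * X ^ j) + + suc m * (c m (suc j) * X ^ suc j))
    ≡⟨ cong (λ u → c (suc m) 0 * 1ℤ + u) (trans (∑-+ (suc m) _ _) (cong₂ _+_ (∑-*ˡ (suc m) X _) (∑-*ˡ (suc m) (+ suc m) _))) ⟩
      + suc m * c m 0 * 1ℤ + (X * S + + suc m * T)
    ≡⟨ regroup (+ suc m) (c m 0) X S T ⟩
      X * S + + suc m * (c m 0 * 1ℤ + T)
    ≡⟨ cong (λ u → X * S + + suc m * u) (sym (∑-shift (suc m) _)) ⟩
      X * S + + suc m * (S + c m (suc m) * X ^ suc m)
    ≡⟨ cong (λ u → X * S + + suc m * (S + u * X ^ suc m)) (risingCoeff-vanish (ℕₚ.n<1+n m)) ⟩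
      X * S + + suc m * (S + 0ℤ * X ^ suc m)
    ≡⟨ factor X S (+ suc m) (X ^ suc m) ⟩
      S * (X + + suc m)
    ≡⟨ cong (_* (X + + suc m)) (sym (rising-expand X m)) ⟩
      rising X (suc m) ∎)
    where
    open ≡-Reasoning
    c = risingCoeff
    S = ∑[ k < suc m ] (c m k * X ^ k)
    T = ∑[ j < suc m ] (c m (suc j) * X ^ suc j)
    distribute : ∀ a b w x c → (a + c * b) * (x * w) ≡ x * (a * w) + c * (b * (x * w))
    distribute = solve-∀
    regroup : ∀ c d x s t → c * d * 1ℤ + (x * s + c * t) ≡ x * s + c * (d * 1ℤ + t)
    regroup = solve-∀
    factor : ∀ x s c w → x * s + c * (s + 0ℤ * w) ≡ s * (x + c)
    factor = solve-∀

module Binomial where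
  open import Data.Nat using (_+_; _*_)
  open import Data.Nat.Combinatorics using (nC1≡n; nCk+nC[k+1]≡[n+1]C[k+1])

  binomial-absorption : ∀ n k → suc k * (suc n C suc k) ≡ suc n * (n C k)
  binomial-absorption zero    zero    = refl
  binomial-absorption zero    (suc k) = ℕₚ.*-zeroʳ (suc (suc k))
  binomial-absorption (suc n) zero    = trans (ℕₚ.*-identityˡ _) (trans (nC1≡n (suc (suc n))) (sym (ℕₚ.*-identityʳ _)))
  binomial-absorption (suc n) (suc k) = begin
      suc (suc k) * (suc (suc n) C suc (suc k))
    ≡⟨ cong (suc (suc k) *_) (sym (nCk+nC[k+1]≡[n+1]C[k+1] (suc n) (suc k))) ⟩
      suc (suc k) * (suc n C suc k + suc n C suc (suc k))
    ≡⟨ spread (suc n C suc k) (suc n C suc (suc k)) k ⟩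
      suc k * (suc n C suc k) + suc n C suc k + suc (suc k) * (suc n C suc (suc k))
    ≡⟨ cong₂ (λ u v → u + suc n C suc k + v) (binomial-absorption n k) (binomial-absorption n (suc k)) ⟩
      suc n * (n C k) + suc n C suc k + suc n * (n C suc k)
    ≡⟨ cong (λ u → suc n * (n C k) + u + suc n * (n C suc k)) (sym (nCk+nC[k+1]≡[n+1]C[k+1] n k)) ⟩
      suc n * (n C k) + (n C k + n C suc k) + suc n * (n C suc k)
    ≡⟨ collect (n C k) (n C suc k) n ⟩
      suc (suc n) * (n C k + n C suc k)
    ≡⟨ cong (suc (suc n) *_) (nCk+nC[k+1]≡[n+1]C[k+1] n k) ⟩
      suc (suc n) * (suc n C suc k) ∎
    where
    open ≡-Reasoning
    spread : ∀ a b k → suc (suc k) * (a + b) ≡ suc k * a + a + suc (suc k) * b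
    spread = ℕ-Solver.solve-∀
    collect : ∀ a b n → suc n * a + (a + b) + suc n * b ≡ suc (suc n) * (a + b)
    collect = ℕ-Solver.solve-∀

module RisingCoeffBinomial where
  open import Data.Integer using (_+_; _*_; 0ℤ; 1ℤ)
  open import Data.Nat.Combinatorics using (nCk+nC[k+1]≡[n+1]C[k+1])
  open BigOperators
  open RisingProduct

  pascal : ∀ n k → + (suc n C suc k) ≡ + (n C k) + + (n C suc k)
  pascal n k = trans (cong +_ (sym (nCk+nC[k+1]≡[n+1]C[k+1] n k))) (ℤₚ.pos-+ (n C k) (n C suc k))

  -- The coefficientwise form of (X + 1)⋯(X + m + 1) = (X + 1) · ((X + 1) + 1)⋯((X + 1) + m).
  risingCoeff-binomial : ∀ m L → suc m ≤ L → ∀ k →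
                         ∑[ j < L ] (risingCoeff m j * + (suc j C k)) ≡ risingCoeff (suc m) k
  risingCoeff-binomial zero (suc L) _ k = begin
      ∑[ j < suc L ] (risingCoeff 0 j * + (suc j C k))
    ≡⟨ ∑-shift L _ ⟩
      1ℤ * + (1 C k) + ∑[ j < L ] (0ℤ * + (suc (suc j) C k))
    ≡⟨ cong (λ u → 1ℤ * + (1 C k) + u) (∑-zero L (λ j _ → ℤₚ.*-zeroˡ (+ (suc (suc j) C k)))) ⟩
      1ℤ * + (1 C k) + 0ℤ
    ≡⟨ base k ⟩
      risingCoeff 1 k ∎
    where
    open ≡-Reasoning
    base : ∀ k → 1ℤ * + (1 C k) + 0ℤ ≡ risingCoeff 1 k
    base zero          = refl
    base (suc zero)    = refl
    base (suc (suc k)) = refl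
  risingCoeff-binomial (suc m) (suc L) (s≤s m<L) k = begin
      ∑< (suc L) a
    ≡⟨ ∑-shift L a ⟩
      a 0 + ∑[ j < L ] a (suc j)
    ≡⟨ cong (λ u → a 0 + u) (∑-cong L (λ j _ → distribute (c m j) (+ suc m) (c m (suc j)) (+ (suc (suc j) C k)))) ⟩
      a 0 + ∑[ j < L ] (c m j * + (suc (suc j) C k) + + suc m * (c m (suc j) * + (suc (suc j) C k)))
    ≡⟨ cong (λ u → a 0 + u) (trans (∑-+ L _ _) (cong (λ u → S₁ + u) (∑-*ˡ L (+ suc m) _))) ⟩
      + suc m * c m 0 * + (1 C k) + (S₁ + + suc m * S₂)
    ≡⟨ regroup (+ suc m) S₁ S₂ (c m 0) (+ (1 C k)) ⟩
      S₁ + + suc m * (c m 0 * + (1 C k) + S₂)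
    ≡⟨ cong (λ u → S₁ + + suc m * u) (sym (∑-shift L _)) ⟩
      S₁ + + suc m * ∑[ j < suc L ] (c m j * + (suc j C k))
    ≡⟨ cong (λ u → S₁ + + suc m * u) (risingCoeff-binomial m (suc L) (ℕₚ.m≤n⇒m≤1+n m<L) k) ⟩
      S₁ + + suc m * c (suc m) k
    ≡⟨ last-step k ⟩
      c (suc (suc m)) k ∎
    where
    open ≡-Reasoning
    c = risingCoeff
    a : ℕ → ℤ
    a j = c (suc m) j * + (suc j C k)
    S₁ = ∑[ j < L ] (c m j * + (suc (suc j) C k))
    S₂ = ∑[ j < L ] (c m (suc j) * + (suc (suc j) C k))
    distribute : ∀ x c y b → (x + c * y) * b ≡ x * b + c * (y * b)
    distribute = solve-∀
    regroup : ∀ c s₁ s₂ d b → c * d * b + (s₁ + c * s₂) ≡ s₁ + c * (d * b + s₂)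
    regroup = solve-∀
    last-step : ∀ k → ∑[ j < L ] (c m j * + (suc (suc j) C k)) + + suc m * c (suc m) k ≡ c (suc (suc m)) k
    last-step zero = trans (cong (_+ + suc m * c (suc m) 0) (risingCoeff-binomial m L m<L zero)) (collect (c (suc m) 0) (+ suc m))
      where
      collect : ∀ x c → x + c * x ≡ (1ℤ + c) * x
      collect = solve-∀
    last-step (suc k) = begin
        ∑[ j < L ] (c m j * + (suc (suc j) C suc k)) + + suc m * c (suc m) (suc k)
      ≡⟨ cong (_+ + suc m * c (suc m) (suc k)) (trans (∑-cong L (λ j _ → trans (cong (c m j *_) (pascal (suc j) k)) (ℤₚ.*-distribˡ-+ (c m j) _ _))) (∑-+ L _ _)) ⟩
        ∑[ j < L ] (c m j * + (suc j C k)) + ∑[ j < L ] (c m j * + (suc j C suc k)) + + suc m * c (suc m) (suc k)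
      ≡⟨ cong₂ (λ u v → u + v + + suc m * c (suc m) (suc k)) (risingCoeff-binomial m L m<L k) (risingCoeff-binomial m L m<L (suc k)) ⟩
        c (suc m) k + c (suc m) (suc k) + + suc m * c (suc m) (suc k)
      ≡⟨ collect (c (suc m) k) (c (suc m) (suc k)) (+ suc m) ⟩
        c (suc (suc m)) (suc k) ∎
      where
      collect : ∀ x y c → x + y + c * y ≡ x + (1ℤ + c) * y
      collect = solve-∀

module PrimeDivisibility {p : ℕ} (p-prime : Prime p) where
  open import Data.Integer using (_+_; _*_; 0ℤ; _^_)
  open Congruence
  open RisingProduct using (risingℕ)
  open BigOperators using (∏<ℕ)

  π : ℤ
  π = + p

  instance
    p≢0 : NonZero p
    p≢0 = prime⇒nonZero p-prime

  p∤1 : ¬ p ∣ 1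
  p∤1 p∣1 = ℕₚ.<⇒≱ (ℕ.nonTrivial⇒n>1 p {{prime⇒nonTrivial p-prime}}) (∣⇒≤ p∣1)

  p∤* : ∀ {a b} → ¬ p ∣ a → ¬ p ∣ b → ¬ p ∣ a ℕ.* b
  p∤* {a} {b} p∤a p∤b p∣ab with euclidsLemma a b p-prime p∣ab
  ... | inj₁ p∣a = p∤a p∣a
  ... | inj₂ p∣b = p∤b p∣b

  p∤<p : ∀ {k} → 0 < k → k < p → ¬ p ∣ k
  p∤<p {suc k} _ k<p p∣k = ℕₚ.<⇒≱ k<p (∣⇒≤ p∣k)

  p∤rising : ∀ {x} k → p ∣ x → k < p → ¬ p ∣ risingℕ x k
  p∤rising zero    p∣x k<p = p∤1
  p∤rising (suc k) p∣x k<p = p∤* (p∤rising k p∣x (ℕₚ.<-trans (ℕₚ.n<1+n k) k<p))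
                                   (λ p∣x+k → p∤<p (s≤s z≤n) k<p (∣m+n∣m⇒∣n p∣x+k p∣x))

  p∤! : ∀ {k} → k < p → ¬ p ∣ k !
  p∤! {zero}  _   = p∤1
  p∤! {suc k} k<p = p∤* (p∤<p (s≤s z≤n) k<p) (p∤! (ℕₚ.<-trans (ℕₚ.n<1+n k) k<p))

  p∤∏ : ∀ K {g} → (∀ m → ¬ p ∣ g m) → ¬ p ∣ ∏<ℕ K g
  p∤∏ zero    p∤g = p∤1
  p∤∏ (suc K) p∤g = p∤* (p∤∏ K p∤g) (p∤g K)

  ∣-to-mod : ∀ x → p ∣ ∣ x ∣ → x ≡ 0ℤ mod π
  ∣-to-mod (+ n)       (divides c refl) = + c , trans (ℤₚ.pos-* c p) (sym (ℤₚ.+-identityˡ _))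
  ∣-to-mod ℤ.-[1+ n ] (divides c eq) = ℤ.- + c ,
    trans (cong (λ u → ℤ.- + u) eq) (trans (cong ℤ.-_ (ℤₚ.pos-* c p))
      (trans (ℤₚ.neg-distribˡ-* (+ c) π) (sym (ℤₚ.+-identityˡ _))))

  mod-to-∣ : ∀ {x} → x ≡ 0ℤ mod π → p ∣ ∣ x ∣
  mod-to-∣ (k , refl) = divides ∣ k ∣ (trans (cong ∣_∣ (ℤₚ.+-identityˡ (k * π))) (ℤₚ.abs-* k π))

  mod-π-cancel : ∀ u x → ¬ p ∣ ∣ u ∣ → u * x ≡ 0ℤ mod π → x ≡ 0ℤ mod π
  mod-π-cancel u x p∤u ux≡0 with euclidsLemma ∣ u ∣ ∣ x ∣ p-prime (subst (p ∣_) (ℤₚ.abs-* u x) (mod-to-∣ ux≡0))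
  ... | inj₁ p∣u = ⊥-elim (p∤u p∣u)
  ... | inj₂ p∣x = ∣-to-mod x p∣x

  mod-πᵏ-cancel : ∀ k u x → ¬ p ∣ ∣ u ∣ → u * x ≡ 0ℤ mod π ^ k → x ≡ 0ℤ mod π ^ k
  mod-πᵏ-cancel zero    u x _   _ = x , solve (x ∷ [])
  mod-πᵏ-cancel (suc k) u x p∤u (l , ux≡lπᵏ⁺¹)
    with mod-π-cancel u x p∤u (mod-divisor (π ^ k) refl (l , ux≡lπᵏ⁺¹))
  ... | y , refl with mod-πᵏ-cancel k u y p∤u (l , ℤₚ.*-cancelʳ-≡ (u * y) (0ℤ + l * π ^ k) π
                        (trans (shift u y π) (trans ux≡lπᵏ⁺¹ (unshift l π (π ^ k)))))
    where
    shift : ∀ u y π → u * y * π ≡ u * (0ℤ + y * π)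
    shift = solve-∀
    unshift : ∀ l π w → 0ℤ + l * (π * w) ≡ (0ℤ + l * w) * π
    unshift = solve-∀
  ...   | m , refl = m , regroup m π (π ^ k)
    where
    regroup : ∀ m π w → 0ℤ + (0ℤ + m * w) * π ≡ 0ℤ + m * (π * w)
    regroup = solve-∀

module RisingCoeffDivisibility {q : ℕ} (p-prime : Prime (suc q)) where
  open import Data.Integer using (_+_; _*_; _-_; 0ℤ; 1ℤ)
  open import Data.Nat.Combinatorics using (nCn≡1; nC1≡n; nCk≡nC[n∸k])
  open Congruence
  open BigOperators
  open RisingProduct
  open Binomial
  open RisingCoeffBinomial
  open PrimeDivisibility p-prime

  private
    c : ℕ → ℤ
    c = risingCoeff q

  p∣binomial : ∀ {k} → k < q → + (suc q C suc k) ≡ 0ℤ mod π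
  p∣binomial {k} k<q = mod-π-cancel (+ suc k) _ (p∤<p (s≤s z≤n) (s≤s k<q))
    (+ (q C k) , trans (sym (ℤₚ.pos-* (suc k) _))
                   (trans (cong +_ (trans (binomial-absorption q k) (ℕₚ.*-comm (suc q) (q C k))))
                          (trans (ℤₚ.pos-* (q C k) (suc q)) (sym (ℤₚ.+-identityˡ _)))))

  [n+1]Cn≡n+1 : ∀ n → suc n C n ≡ suc n
  [n+1]Cn≡n+1 n = trans (nCk≡nC[n∸k] (ℕₚ.n≤1+n n)) (trans (cong (suc n C_) (ℕₚ.m+n∸n≡m 1 n)) (nC1≡n (suc n)))

  -- Reduce ∑ⱼ c j · C(j+1, i+1) = c i + p · c (i+1) modulo p: below j = i the binomials vanish,
  -- j = i and j = i + 1 give c i + (i+2) · c (i+1), the coefficients up to j = q - 1 are divisible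
  -- by p by hypothesis, and j = q gives C(p, i+1).
  risingCoeff-step : ∀ i r → q ≡ i ℕ.+ (2 ℕ.+ r) →
                     (∀ j → j < r → c (i ℕ.+ (2 ℕ.+ j)) ≡ 0ℤ mod π) → c (suc i) ≡ 0ℤ mod π
  risingCoeff-step i r q≡ hyp = mod-π-cancel (+ suc (suc i)) (c (suc i)) (p∤<p (s≤s z≤n) (s≤s i+2≤q)) key
    where
    i+2≤q : suc (suc i) ≤ q
    i+2≤q = subst (suc (suc i) ≤_) (sym q≡)
              (subst (ℕ._≤ i ℕ.+ (2 ℕ.+ r)) (ℕₚ.+-comm i 2) (ℕₚ.+-monoʳ-≤ i (ℕₚ.m≤m+n 2 r)))
    a : ℕ → ℤ
    a j = c j * + (suc j C suc i)
    b : ℕ → ℤ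
    b j = a (i ℕ.+ j)
    S = ∑< (suc q) a
    S≡ : S ≡ c i + π * c (suc i)
    S≡ = risingCoeff-binomial q (suc q) ℕₚ.≤-refl (suc i)
    unfold : ∑< (i ℕ.+ (3 ℕ.+ r)) a ≡ ∑< i a + (b 0 + (b 1 + (∑[ j < r ] b (2 ℕ.+ j) + b (2 ℕ.+ r))))
    unfold = trans (∑-split i (3 ℕ.+ r) a)
               (cong (λ u → ∑< i a + u) (trans (∑-shift (2 ℕ.+ r) b) (cong (λ u → b 0 + u) (∑-shift (suc r) (λ j → b (suc j))))))
    below : ∑< i a ≡ 0ℤ
    below = ∑-zero i (λ j j<i → trans (cong (c j *_) (cong +_ (k>n⇒nCk≡0 (s≤s j<i)))) (ℤₚ.*-zeroʳ (c j)))
    b0 : b 0 ≡ c i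
    b0 = trans (cong (λ x → c x * + (suc x C suc i)) (ℕₚ.+-identityʳ i))
               (trans (cong (λ n → c i * + n) (nCn≡1 (suc i))) (ℤₚ.*-identityʳ (c i)))
    b1 : b 1 ≡ c (suc i) * + suc (suc i)
    b1 = trans (cong (λ x → c x * + (suc x C suc i)) (ℕₚ.+-comm i 1)) (cong (λ n → c (suc i) * + n) ([n+1]Cn≡n+1 (suc i)))
    middle : ∑[ j < r ] b (2 ℕ.+ j) ≡ 0ℤ mod π
    middle = mod-trans (∑-mod r {g = λ _ → 0ℤ} vanishing) (mod-reflexive (∑-zero r (λ _ _ → refl)))
      where
      vanishing : ∀ j → j < r → b (2 ℕ.+ j) ≡ 0ℤ mod π
      vanishing j j<r = mod-trans (mod-*ʳ binom (hyp j j<r)) (mod-reflexive (ℤₚ.*-zeroˡ binom))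
        where binom = + (suc (i ℕ.+ (2 ℕ.+ j)) C suc i)
    top : b (2 ℕ.+ r) ≡ 0ℤ mod π
    top = subst (λ m → c m * + (suc m C suc i) ≡ 0ℤ mod π) q≡
            (mod-trans (mod-* (mod-reflexive (risingCoeff-diag q)) (p∣binomial (subst (i <_) (sym q≡) (ℕₚ.m<m+n i (s≤s z≤n)))))
                       (mod-reflexive (ℤₚ.*-zeroʳ 1ℤ)))
    S-mod-π : S ≡ c i + c (suc i) * + suc (suc i) mod π
    S-mod-π = begin
        S
      ≡⟨ trans (cong (λ m → ∑< (suc m) a) q≡) (trans (cong (λ m → ∑< m a) (sym (ℕₚ.+-suc i (2 ℕ.+ r)))) unfold) ⟩
        ∑< i a + (b 0 + (b 1 + (∑[ j < r ] b (2 ℕ.+ j) + b (2 ℕ.+ r))))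
      ≈⟨ mod-+ (mod-reflexive below) (mod-+ (mod-refl (b 0)) (mod-+ (mod-refl (b 1)) (mod-+ middle top))) ⟩
        0ℤ + (b 0 + (b 1 + (0ℤ + 0ℤ)))
      ≡⟨ trans (drop-zeros (b 0) (b 1)) (cong₂ _+_ b0 b1) ⟩
        c i + c (suc i) * + suc (suc i) ∎
      where
      open mod-Reasoning π
      drop-zeros : ∀ x y → 0ℤ + (x + (y + (0ℤ + 0ℤ))) ≡ x + y
      drop-zeros = solve-∀
    key : + suc (suc i) * c (suc i) ≡ 0ℤ mod π
    key = begin
        + suc (suc i) * c (suc i)
      ≡⟨ isolate (c i) (c (suc i)) (+ suc (suc i)) ⟩
        (c i + c (suc i) * + suc (suc i)) - c i
      ≈⟨ mod-- (mod-sym S-mod-π) (mod-refl (c i)) ⟩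
        S - c i
      ≡⟨ trans (cong (_- c i) S≡) (cancel (c i) (c (suc i)) π) ⟩
        0ℤ + c (suc i) * π
      ≈⟨ mod-multiple 0ℤ (c (suc i)) ⟩
        0ℤ ∎
      where
      open mod-Reasoning π
      isolate : ∀ x y k → k * y ≡ (x + y * k) - x
      isolate = solve-∀
      cancel : ∀ x y π → (x + π * y) - x ≡ 0ℤ + y * π
      cancel = solve-∀

  p∣risingCoeff : ∀ {k} → 0 < k → suc k ≤ q → c k ≡ 0ℤ mod π
  p∣risingCoeff {suc i} _ i+2≤q =
    claim (q ℕ.∸ (2 ℕ.+ i)) i (trans (sym (ℕₚ.m+[n∸m]≡n i+2≤q)) (swap i (q ℕ.∸ (2 ℕ.+ i))))
    where
    swap : ∀ i s → (2 ℕ.+ i) ℕ.+ s ≡ i ℕ.+ (2 ℕ.+ s)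
    swap = ℕ-Solver.solve-∀
    reindex : ∀ i j → suc (suc i ℕ.+ j) ≡ i ℕ.+ (2 ℕ.+ j)
    reindex = ℕ-Solver.solve-∀
    regroup : ∀ i j s → i ℕ.+ (2 ℕ.+ (suc j ℕ.+ s)) ≡ (suc i ℕ.+ j) ℕ.+ (2 ℕ.+ s)
    regroup = ℕ-Solver.solve-∀
    Claim : ℕ → Set
    Claim r = ∀ i → q ≡ i ℕ.+ (2 ℕ.+ r) → c (suc i) ≡ 0ℤ mod π
    claim : ∀ r → Claim r
    claim = <-rec Claim λ r rec i q≡ → risingCoeff-step i r q≡ λ j j<r →
      subst (λ x → c x ≡ 0ℤ mod π) (reindex i j)
        (rec (ℕₚ.∸-monoʳ-< {r} {suc j} {0} (s≤s z≤n) j<r) (suc i ℕ.+ j)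
          (trans q≡ (trans (cong (λ x → i ℕ.+ (2 ℕ.+ x)) (sym (ℕₚ.m+[n∸m]≡n j<r))) (regroup i j (r ℕ.∸ suc j)))))

module Reflection where
  open import Data.Integer using (_+_; _*_; -_; 1ℤ)
  open RisingProduct

  sgnℤ : ℕ → ℤ
  sgnℤ zero    = 1ℤ
  sgnℤ (suc k) = - sgnℤ k

  sgnℤ-even : ∀ t → sgnℤ (t ℕ.+ t) ≡ 1ℤ
  sgnℤ-even zero    = refl
  sgnℤ-even (suc t) = trans (cong (λ n → sgnℤ (suc n)) (ℕₚ.+-suc t t))
                            (trans (ℤₚ.neg-involutive (sgnℤ (t ℕ.+ t))) (sgnℤ-even t))

  rising-suc : ∀ x k → rising x (suc k) ≡ (x + 1ℤ) * rising (x + 1ℤ) k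
  rising-suc x zero    = commute x
    where
    commute : ∀ x → 1ℤ * (x + 1ℤ) ≡ (x + 1ℤ) * 1ℤ
    commute = solve-∀
  rising-suc x (suc k) = trans (cong (_* (x + + suc (suc k))) (rising-suc x k)) (regroup x (rising (x + 1ℤ) k) (+ k))
    where
    regroup : ∀ x P k → (x + 1ℤ) * P * (x + (1ℤ + (1ℤ + k))) ≡ (x + 1ℤ) * (P * ((x + 1ℤ) + (1ℤ + k)))
    regroup = solve-∀

  rising-reflect : ∀ x k → rising (- (x + + suc k)) k ≡ sgnℤ k * rising x k
  rising-reflect x zero    = refl
  rising-reflect x (suc k) = begin
      rising (- (x + + suc (suc k))) k * (- (x + + suc (suc k)) + + suc k)
    ≡⟨ cong₂ (λ u v → rising u k * v) (shift x (+ k)) (last x (+ k)) ⟩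
      rising (- ((x + 1ℤ) + + suc k)) k * (- (x + 1ℤ))
    ≡⟨ cong (_* (- (x + 1ℤ))) (rising-reflect (x + 1ℤ) k) ⟩
      sgnℤ k * rising (x + 1ℤ) k * (- (x + 1ℤ))
    ≡⟨ regroup (sgnℤ k) (rising (x + 1ℤ) k) x ⟩
      - sgnℤ k * ((x + 1ℤ) * rising (x + 1ℤ) k)
    ≡⟨ cong (- sgnℤ k *_) (sym (rising-suc x k)) ⟩
      - sgnℤ k * rising x (suc k) ∎
    where
    open ≡-Reasoning
    shift : ∀ x k → - (x + (1ℤ + (1ℤ + k))) ≡ - ((x + 1ℤ) + (1ℤ + k))
    shift = solve-∀
    last : ∀ x k → - (x + (1ℤ + (1ℤ + k))) + (1ℤ + k) ≡ - (x + 1ℤ)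
    last = solve-∀
    regroup : ∀ s P x → s * P * (- (x + 1ℤ)) ≡ - s * ((x + 1ℤ) * P)
    regroup = solve-∀

module Harmonic where
  open import Data.Integer using (_+_; _*_; 0ℤ)
  open Fraction
  open RisingProduct
  open Reflection

  harmonicNumerator : ℕ → ℤ
  harmonicNumerator zero    = 0ℤ
  harmonicNumerator (suc m) = harmonicNumerator m * + suc m + + (m !)

  pos-! : ∀ m → + (suc m !) ≡ + (m !) * + suc m
  pos-! m = trans (ℤₚ.pos-* (suc m) (m !)) (ℤₚ.*-comm (+ suc m) (+ (m !)))

  rising-0 : ∀ k → rising 0ℤ k ≡ + (k !)
  rising-0 zero    = refl
  rising-0 (suc k) = trans (cong₂ _*_ (rising-0 k) (ℤₚ.+-identityˡ (+ suc k))) (sym (pos-! k))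

  ÷-H1 : ∀ m → H1 m ≐ harmonicNumerator m ÷ + (m !)
  ÷-H1 zero    = fraction 0 refl refl
  ÷-H1 (suc m) = ÷-reshape (÷-+ (÷-H1 m) (÷-÷ℕ 1 (s≤s z≤n)))
                           (cong (λ u → harmonicNumerator m * + suc m + u) (ℤₚ.*-identityˡ (+ (m !)))) (sym (pos-! m))

  ÷-sgn : ∀ k → sgn k ≐ sgnℤ k ÷ + 1
  ÷-sgn zero    = fraction 0 refl refl
  ÷-sgn (suc k) = ÷-neg (÷-sgn k)

  risingCoeff-0 : ∀ m → risingCoeff m 0 ≡ + (m !)
  risingCoeff-0 zero    = refl
  risingCoeff-0 (suc m) = trans (cong (+ suc m *_) (risingCoeff-0 m)) (sym (ℤₚ.pos-* (suc m) (m !)))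

  risingCoeff-1 : ∀ m → risingCoeff m 1 ≡ harmonicNumerator m
  risingCoeff-1 zero    = refl
  risingCoeff-1 (suc m) = trans (cong₂ (λ u v → u + + suc m * v) (risingCoeff-0 m) (risingCoeff-1 m))
                                (commute (+ (m !)) (+ suc m) (harmonicNumerator m))
    where
    commute : ∀ f c h → f + c * h ≡ h * c + f
    commute = solve-∀

module Parity where
  parity : ∀ m → ∃ λ t → m ≡ t ℕ.+ t ⊎ m ≡ suc (t ℕ.+ t)
  parity zero    = 0 , inj₁ refl
  parity (suc m) with parity m
  ... | t , inj₁ m≡2t   = t , inj₂ (cong suc m≡2t)
  ... | t , inj₂ m≡2t+1 = suc t , inj₁ (cong suc (trans m≡2t+1 (sym (ℕₚ.+-suc t t))))

  prime-pred-even : ∀ {q} → Prime (suc q) → 2 ≤ q → ∃ λ t → q ≡ t ℕ.+ t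
  prime-pred-even {q} p-prime 2≤q with parity q
  ... | t , inj₁ q≡2t   = t , q≡2t
  ... | t , inj₂ q≡2t+1 with prime⇒irreducible p-prime {2} (divides (suc t) (trans (cong suc q≡2t+1) (double t)))
    where
    double : ∀ t → suc (suc (t ℕ.+ t)) ≡ suc t ℕ.* 2
    double = ℕ-Solver.solve-∀
  ...   | inj₁ ()
  ...   | inj₂ 2≡p = ⊥-elim (ℕₚ.<⇒≢ (s≤s 2≤q) 2≡p)

module RisingAtMultiples {q} (p-prime : Prime (suc q)) (6≤q : 6 ≤ q) where
  open import Data.Integer using (_+_; _*_; -_; _-_; 0ℤ; 1ℤ; _^_)
  open Congruence
  open BigOperators
  open RisingProduct
  open Reflection
  open PrimeDivisibility p-prime
  open RisingCoeffDivisibility p-prime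

  π⁵ : ℤ
  π⁵ = π ^ 5

  π⁵-unfold : π⁵ ≡ π * π * π * π * π
  π⁵-unfold = unfold π
    where
    unfold : ∀ x → x * (x * (x * (x * (x * 1ℤ)))) ≡ x * x * x * x * x
    unfold = solve-∀

  by-π⁵ : ∀ {a b} k → a ≡ b + k * (π * π * π * π * π) → a ≡ b mod π⁵
  by-π⁵ {b = b} k a≡ = k , trans a≡ (cong (λ u → b + k * u) (sym π⁵-unfold))

  F : ℤ → ℤ
  F a = rising (a * π) q

  private
    c : ℕ → ℤ
    c = risingCoeff q

  E : ℤ → ℤ
  E a = c 0 + c 1 * x + c 2 * (x * x) + c 3 * (x * x * x) + c 4 * (x * x * x * x)
    where x = a * π

  ^-distribʳ-* : ∀ x y k → (x * y) ^ k ≡ x ^ k * y ^ k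
  ^-distribʳ-* x y zero    = refl
  ^-distribʳ-* x y (suc k) = trans (cong ((x * y) *_) (^-distribʳ-* x y k)) (interchange x y (x ^ k) (y ^ k))
    where
    interchange : ∀ x y u v → x * y * (u * v) ≡ x * u * (y * v)
    interchange = solve-∀

  truncate : ∀ X j → ∑[ k < 5 ℕ.+ j ] (c k * (X * π) ^ k) ≡ ∑[ k < 5 ] (c k * (X * π) ^ k) mod π⁵
  truncate X zero    = mod-refl _
  truncate X (suc j) = mod-trans (mod-+ (truncate X j) high-term) (mod-reflexive (ℤₚ.+-identityʳ _))
    where
    k = 5 ℕ.+ j
    high-term : c k * (X * π) ^ k ≡ 0ℤ mod π⁵
    high-term = c k * X ^ k * π ^ j ,
      trans (cong (c k *_) (trans (^-distribʳ-* X π k) (cong (X ^ k *_) (ℤₚ.^-distribˡ-+-* π 5 j))))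
            (regroup (c k) (X ^ k) π⁵ (π ^ j))
      where
      regroup : ∀ d x a b → d * (x * (a * b)) ≡ 0ℤ + d * x * b * a
      regroup = solve-∀

  F≡E : ∀ a → F a ≡ E a mod π⁵
  F≡E a = begin
      F a
    ≡⟨ rising-expand (a * π) q ⟩
      ∑[ k < suc q ] (c k * (a * π) ^ k)
    ≡⟨ cong (λ m → ∑[ k < m ] (c k * (a * π) ^ k)) (sym 5+[q∸4]≡q+1) ⟩
      ∑[ k < 5 ℕ.+ (q ℕ.∸ 4) ] (c k * (a * π) ^ k)
    ≈⟨ truncate a (q ℕ.∸ 4) ⟩
      ∑[ k < 5 ] (c k * (a * π) ^ k)
    ≡⟨ unfold (c 0) (c 1) (c 2) (c 3) (c 4) (a * π) ⟩
      E a ∎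
    where
    open mod-Reasoning π⁵
    5+[q∸4]≡q+1 : 5 ℕ.+ (q ℕ.∸ 4) ≡ suc q
    5+[q∸4]≡q+1 = cong suc (ℕₚ.m+[n∸m]≡n (ℕₚ.≤-trans (ℕₚ.n≤1+n 4) (ℕₚ.≤-trans (ℕₚ.n≤1+n 5) 6≤q)))
    unfold : ∀ d₀ d₁ d₂ d₃ d₄ x →
      0ℤ + d₀ * 1ℤ + d₁ * (x * 1ℤ) + d₂ * (x * (x * 1ℤ)) + d₃ * (x * (x * (x * 1ℤ))) + d₄ * (x * (x * (x * (x * 1ℤ))))
      ≡ d₀ + d₁ * x + d₂ * (x * x) + d₃ * (x * x * x) + d₄ * (x * x * x * x)
    unfold = solve-∀

  -- Since p - 1 is even, F is symmetric about a = -1/2.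
  F-reflect : ∀ a → F (- (a + 1ℤ)) ≡ F a
  F-reflect a = begin
      rising (- (a + 1ℤ) * π) q
    ≡⟨ cong (λ x → rising x q) (distribute a π) ⟩
      rising (- (a * π + π)) q
    ≡⟨ rising-reflect (a * π) q ⟩
      sgnℤ q * F a
    ≡⟨ cong (_* F a) (trans (cong sgnℤ (proj₂ q-even)) (sgnℤ-even (proj₁ q-even))) ⟩
      1ℤ * F a
    ≡⟨ ℤₚ.*-identityˡ (F a) ⟩
      F a ∎
    where
    open ≡-Reasoning
    q-even = Parity.prime-pred-even p-prime (ℕₚ.≤-trans (s≤s (s≤s z≤n)) 6≤q)
    distribute : ∀ a π → - (a + 1ℤ) * π ≡ - (a * π + π)
    distribute = solve-∀

  C₂ C₃ C₄ : ℤ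
  C₂ = c 2 * (π * π) - c 1 * π
  C₃ = c 3 * (π * π * π)
  C₄ = c 4 * (π * π * π * π)

  C₄≡0 : C₄ ≡ 0ℤ mod π⁵
  C₄≡0 = raise (p∣risingCoeff {4} (s≤s z≤n) (ℕₚ.≤-trans (ℕₚ.n≤1+n 5) 6≤q))
    where
    regroup : ∀ k x → (0ℤ + k * x) * (x * x * x * x) ≡ 0ℤ + k * (x * x * x * x * x)
    regroup = solve-∀
    raise : c 4 ≡ 0ℤ mod π → C₄ ≡ 0ℤ mod π⁵
    raise (k , c₄≡kπ) = by-π⁵ k (trans (cong (_* (π * π * π * π)) c₄≡kπ) (regroup k π))

  E-reflect : ∀ a → E (- (a + 1ℤ)) ≡ E a mod π⁵
  E-reflect a = mod-trans (mod-sym (F≡E (- (a + 1ℤ)))) (mod-trans (mod-reflexive (F-reflect a)) (F≡E a))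

  C₂-C₃≡0 : C₂ - C₃ ≡ 0ℤ mod π⁵
  C₂-C₃≡0 = begin
      C₂ - C₃
    ≡⟨ difference (c 0) (c 1) (c 2) (c 3) (c 4) π ⟩
      (E (- (0ℤ + 1ℤ)) - E 0ℤ) - C₄
    ≈⟨ mod-- (mod-- (E-reflect 0ℤ) (mod-refl (E 0ℤ))) C₄≡0 ⟩
      (E 0ℤ - E 0ℤ) - 0ℤ
    ≡⟨ cancel (E 0ℤ) ⟩
      0ℤ ∎
    where
    open mod-Reasoning π⁵
    difference : ∀ d₀ d₁ d₂ d₃ d₄ π → let x = - (0ℤ + 1ℤ) * π ; y = 0ℤ * π in
      d₂ * (π * π) - d₁ * π - d₃ * (π * π * π)
      ≡ ((d₀ + d₁ * x + d₂ * (x * x) + d₃ * (x * x * x) + d₄ * (x * x * x * x))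
         - (d₀ + d₁ * y + d₂ * (y * y) + d₃ * (y * y * y) + d₄ * (y * y * y * y)))
        - d₄ * (π * π * π * π)
    difference = solve-∀
    cancel : ∀ e → (e - e) - 0ℤ ≡ 0ℤ
    cancel = solve-∀

  9C₃-3C₂≡0 : C₃ * + 9 - C₂ * + 3 ≡ 0ℤ mod π⁵
  9C₃-3C₂≡0 = begin
      C₃ * + 9 - C₂ * + 3
    ≡⟨ difference (c 0) (c 1) (c 2) (c 3) (c 4) π ⟩
      (E 1ℤ - E (- (1ℤ + 1ℤ))) + C₄ * + 15
    ≈⟨ mod-+ (mod-- (mod-sym (E-reflect 1ℤ)) (mod-refl (E (- (1ℤ + 1ℤ))))) (mod-*ʳ (+ 15) C₄≡0) ⟩
      (E (- (1ℤ + 1ℤ)) - E (- (1ℤ + 1ℤ))) + 0ℤ * + 15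
    ≡⟨ cancel (E (- (1ℤ + 1ℤ))) ⟩
      0ℤ ∎
    where
    open mod-Reasoning π⁵
    difference : ∀ d₀ d₁ d₂ d₃ d₄ π → let x = 1ℤ * π ; y = - (1ℤ + 1ℤ) * π in
      d₃ * (π * π * π) * + 9 - (d₂ * (π * π) - d₁ * π) * + 3
      ≡ ((d₀ + d₁ * x + d₂ * (x * x) + d₃ * (x * x * x) + d₄ * (x * x * x * x))
         - (d₀ + d₁ * y + d₂ * (y * y) + d₃ * (y * y * y) + d₄ * (y * y * y * y)))
        + d₄ * (π * π * π * π) * + 15
    difference = solve-∀
    cancel : ∀ e → (e - e) + 0ℤ * + 15 ≡ 0ℤ
    cancel = solve-∀

  -- 6 C₃ is a combination of the two relations above, and p ∤ 6.
  C₃≡0 : C₃ ≡ 0ℤ mod π⁵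
  C₃≡0 = mod-πᵏ-cancel 5 (+ 6) C₃ (p∤<p (s≤s z≤n) (s≤s 6≤q)) (begin
      + 6 * C₃
    ≡⟨ combine C₂ C₃ ⟩
      (C₃ * + 9 - C₂ * + 3) + (C₂ - C₃) * + 3
    ≈⟨ mod-+ 9C₃-3C₂≡0 (mod-*ʳ (+ 3) C₂-C₃≡0) ⟩
      0ℤ + 0ℤ * + 3
    ≡⟨⟩
      0ℤ ∎)
    where
    open mod-Reasoning π⁵
    combine : ∀ a b → + 6 * b ≡ (b * + 9 - a * + 3) + (a - b) * + 3
    combine = solve-∀

  C₂≡0 : C₂ ≡ 0ℤ mod π⁵
  C₂≡0 = mod-trans (mod-reflexive (split C₂ C₃)) (mod-+ C₂-C₃≡0 C₃≡0)
    where
    split : ∀ a b → a ≡ (a - b) + b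
    split = solve-∀

  F-mod-π⁵ : ∀ a → F a ≡ c 0 + a * (a + 1ℤ) * π * c 1 mod π⁵
  F-mod-π⁵ a = begin
      F a
    ≈⟨ F≡E a ⟩
      E a
    ≡⟨ regroup (c 0) (c 1) (c 2) (c 3) (c 4) π a ⟩
      (c 0 + a * (a + 1ℤ) * π * c 1) + (C₂ * (a * a) + C₃ * (a * a * a) + C₄ * (a * a * a * a))
    ≈⟨ mod-+ (mod-refl (c 0 + a * (a + 1ℤ) * π * c 1))
             (mod-+ (mod-+ (mod-*ʳ (a * a) C₂≡0) (mod-*ʳ (a * a * a) C₃≡0)) (mod-*ʳ (a * a * a * a) C₄≡0)) ⟩
      (c 0 + a * (a + 1ℤ) * π * c 1) + (0ℤ * (a * a) + 0ℤ * (a * a * a) + 0ℤ * (a * a * a * a))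
    ≡⟨ drop-zeros (c 0 + a * (a + 1ℤ) * π * c 1) a ⟩
      c 0 + a * (a + 1ℤ) * π * c 1 ∎
    where
    open mod-Reasoning π⁵
    regroup : ∀ d₀ d₁ d₂ d₃ d₄ π a → let x = a * π in
      d₀ + d₁ * x + d₂ * (x * x) + d₃ * (x * x * x) + d₄ * (x * x * x * x)
      ≡ (d₀ + a * (a + 1ℤ) * π * d₁)
        + ((d₂ * (π * π) - d₁ * π) * (a * a) + d₃ * (π * π * π) * (a * a * a) + d₄ * (π * π * π * π) * (a * a * a * a))
    regroup = solve-∀
    drop-zeros : ∀ e a → e + (0ℤ * (a * a) + 0ℤ * (a * a * a) + 0ℤ * (a * a * a * a)) ≡ e
    drop-zeros = solve-∀

module Wolstenholme {q} (p-prime : Prime (suc q)) (w : ℕ)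
                    (H1≡w : CongModPow (suc q) 2 (H1 q ℚ.* (1 ÷ℕ (suc q ℕ.^ 2))) (ℕtoℚ w)) where
  open import Data.Integer using (_+_; _*_; -_; _-_; 0ℤ; 1ℤ; _^_)
  open Congruence
  open Fraction
  open BigOperators
  open Harmonic
  open PrimeDivisibility p-prime

  -- Clearing the denominators of H₁(p-1)/p² - w = z p² (z p-integral) gives
  -- ↧z · (H - (p-1)! w p²) = ↥z (p-1)! p⁴ for the numerator H of H₁(p-1) over (p-1)!.
  harmonicNumerator-mod-π⁴ : harmonicNumerator q ≡ + (q !) * + w * (π * π) mod π ^ 4
  harmonicNumerator-mod-π⁴ = mod-trans (mod-reflexive (split H W))
                          (mod-trans (mod-+ (mod-πᵏ-cancel 4 (↧ z) (H - W) p∤↧z cleared) (mod-refl W))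
                                     (mod-reflexive (ℤₚ.+-identityˡ W)))
    where
    z = proj₁ H1≡w
    p∤↧z = proj₁ (proj₂ H1≡w)
    H = harmonicNumerator q
    W = + (q !) * + w * (π * π)
    p²≡ : + (suc q ℕ.^ 2) ≡ π * π
    p²≡ = trans (pos-^ (suc q) 2) (cong (π *_) (ℤₚ.*-identityʳ π))
    integral : (H * + 1 * + 1 + - + w * (+ (q !) * (π * π))) * (↧ z * + 1) ≡ ↥ z * (π * π) * (+ (q !) * (π * π) * + 1)
    integral = subst (λ P → (H * + 1 * + 1 + - + w * (+ (q !) * P)) * (↧ z * + 1) ≡ ↥ z * P * (+ (q !) * P * + 1)) p²≡
                 (÷-≡⁻¹ (÷-- (÷-* (÷-H1 q) (÷-÷ℕ 1 (ℕₚ.m^n>0 (suc q) 2))) (÷-ℕ w))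
                        (÷-* (÷-reduced z) (÷-ℕ (suc q ℕ.^ 2)))
                        (proj₂ (proj₂ H1≡w)))
    cleared : ↧ z * (H - W) ≡ 0ℤ mod π ^ 4
    cleared = by-π⁴ (↥ z * + (q !)) (trans (rearrange H (+ w) (+ (q !)) π (↧ z)) (trans integral (regroup (↥ z) π (+ (q !)))))
      where
      rearrange : ∀ h w f π d → d * (h - f * w * (π * π)) ≡ (h * + 1 * + 1 + - w * (f * (π * π))) * (d * + 1)
      rearrange = solve-∀
      regroup : ∀ z π f → z * (π * π) * (f * (π * π) * + 1) ≡ 0ℤ + z * f * (π * (π * (π * (π * 1ℤ))))
      regroup = solve-∀
      by-π⁴ : ∀ {a} k → a ≡ 0ℤ + k * π ^ 4 → a ≡ 0ℤ mod π ^ 4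
      by-π⁴ k eq = k , eq
    split : ∀ a b → a ≡ (a - b) + b
    split = solve-∀

module RisingAtMultiplesW {q} (p-prime : Prime (suc q)) (6≤q : 6 ≤ q) (w : ℕ)
                          (H1≡w : CongModPow (suc q) 2 (H1 q ℚ.* (1 ÷ℕ (suc q ℕ.^ 2))) (ℕtoℚ w)) where
  open import Data.Integer using (_+_; _*_; 0ℤ; 1ℤ)
  open Congruence
  open BigOperators
  open RisingProduct
  open Harmonic
  open PrimeDivisibility p-prime
  open RisingAtMultiples p-prime 6≤q public
  open Wolstenholme p-prime w H1≡w

  c₃ : ℤ
  c₃ = + w * (π * π * π)

  F-mod-π⁵-w : ∀ a → F a ≡ + (q !) * (1ℤ + a * (a + 1ℤ) * c₃) mod π⁵
  F-mod-π⁵-w a = begin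
      F a
    ≈⟨ F-mod-π⁵ a ⟩
      risingCoeff q 0 + a * (a + 1ℤ) * π * risingCoeff q 1
    ≡⟨ cong₂ (λ u v → u + a * (a + 1ℤ) * π * v) (risingCoeff-0 q) (risingCoeff-1 q) ⟩
      + (q !) + a * (a + 1ℤ) * π * harmonicNumerator q
    ≡⟨ cong (λ u → + (q !) + u) (ℤₚ.*-assoc (a * (a + 1ℤ)) π (harmonicNumerator q)) ⟩
      + (q !) + a * (a + 1ℤ) * (π * harmonicNumerator q)
    ≈⟨ mod-+ (mod-refl (+ (q !))) (mod-*ˡ (a * (a + 1ℤ)) (mod-scale π harmonicNumerator-mod-π⁴)) ⟩
      + (q !) + a * (a + 1ℤ) * (π * (+ (q !) * + w * (π * π)))
    ≡⟨ factor (+ (q !)) a (+ w) π ⟩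
      + (q !) * (1ℤ + a * (a + 1ℤ) * c₃) ∎
    where
    open mod-Reasoning π⁵
    factor : ∀ f a w π → f + a * (a + 1ℤ) * (π * (f * w * (π * π))) ≡ f * (1ℤ + a * (a + 1ℤ) * (w * (π * π * π)))
    factor = solve-∀

  -- ∑_{m<K} [(D+m)(D+m+1) - m(m+1)] = D K (D+K) telescopes the first-order terms.
  ∏F-shift : ∀ D K → ∏[ m < K ] F (D + + m) ≡ ∏[ m < K ] F (+ m) * (1ℤ + c₃ * (D * + K * (D + + K))) mod π⁵
  ∏F-shift D zero    = mod-reflexive (empty D c₃)
    where
    empty : ∀ D c → 1ℤ ≡ 1ℤ * (1ℤ + c * (D * 0ℤ * (D + 0ℤ)))
    empty = solve-∀
  ∏F-shift D (suc K) = begin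
      ∏[ m < K ] F (D + + m) * F (D + + K)
    ≈⟨ mod-* (∏F-shift D K) (F-mod-π⁵-w (D + + K)) ⟩
      Y * (1ℤ + c₃ * (D * + K * (D + + K))) * (+ (q !) * (1ℤ + (D + + K) * ((D + + K) + 1ℤ) * c₃))
    ≈⟨ by-π⁵ (Y * + (q !) * + w * + w * π * (D * + K * (D + + K) * ((D + + K) * ((D + + K) + 1ℤ)) - + K * (+ K + 1ℤ) * (D * (1ℤ + + K) * (D + (1ℤ + + K)))))
             (expand Y (+ (q !)) (+ w) π D (+ K)) ⟩
      Y * (+ (q !) * (1ℤ + + K * (+ K + 1ℤ) * c₃)) * (1ℤ + c₃ * (D * + suc K * (D + + suc K)))
    ≈⟨ mod-*ʳ (1ℤ + c₃ * (D * + suc K * (D + + suc K))) (mod-*ˡ Y (mod-sym (F-mod-π⁵-w (+ K)))) ⟩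
      Y * F (+ K) * (1ℤ + c₃ * (D * + suc K * (D + + suc K))) ∎
    where
    open mod-Reasoning π⁵
    open import Data.Integer using (_-_)
    Y = ∏[ m < K ] F (+ m)
    expand : ∀ Y f w π D k →
      Y * (1ℤ + w * (π * π * π) * (D * k * (D + k))) * (f * (1ℤ + (D + k) * ((D + k) + 1ℤ) * (w * (π * π * π))))
      ≡ Y * (f * (1ℤ + k * (k + 1ℤ) * (w * (π * π * π)))) * (1ℤ + w * (π * π * π) * (D * (1ℤ + k) * (D + (1ℤ + k))))
        + Y * f * w * w * π * (D * k * (D + k) * ((D + k) * ((D + k) + 1ℤ)) - k * (k + 1ℤ) * (D * (1ℤ + k) * (D + (1ℤ + k)))) * (π * π * π * π * π)
    expand = solve-∀

module Factorials where
  open import Data.Nat using (_+_; _*_; _∸_)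
  open RisingProduct using (risingℕ)

  binomial-factorials : ∀ {n k} → k ≤ n → (n C k) * (k ! * (n ∸ k) !) ≡ n !
  binomial-factorials {n} {k} k≤n =
    trans (cong (_* (k ! * (n ∸ k) !)) (nCk≡n!/k![n-k]! k≤n))
          (m/n*n≡m {{ℕₚ.m*n≢0 (k !) ((n ∸ k) !) {{k ℕₚ.!≢0}} {{(n ∸ k) ℕₚ.!≢0}}}} (k![n∸k]!∣n! k≤n))

  binomial-factorials′ : ∀ a b → ((a + b) C b) * (b ! * a !) ≡ (a + b) !
  binomial-factorials′ a b = trans (cong (λ x → ((a + b) C b) * (b ! * x !)) (sym (ℕₚ.m+n∸n≡m a b)))
                                   (binomial-factorials (ℕₚ.m≤n+m b a))

  C-pos : ∀ {n k} → k ≤ n → 0 < n C k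
  C-pos {n} {k} k≤n with n C k | binomial-factorials k≤n
  ... | zero  | 0≡n! = ⊥-elim (ℕ.≢-nonZero⁻¹ (n !) {{n ℕₚ.!≢0}} (sym 0≡n!))
  ... | suc _ | _    = s≤s z≤n

  !-rising : ∀ x k → (x + k) ! ≡ x ! * risingℕ x k
  !-rising x zero    = trans (cong _! (ℕₚ.+-identityʳ x)) (sym (ℕₚ.*-identityʳ (x !)))
  !-rising x (suc k) = begin
      (x + suc k) !
    ≡⟨ cong _! (ℕₚ.+-suc x k) ⟩
      suc (x + k) * (x + k) !
    ≡⟨ cong (suc (x + k) *_) (!-rising x k) ⟩
      suc (x + k) * (x ! * risingℕ x k)
    ≡⟨ regroup (x !) (risingℕ x k) x k ⟩
      x ! * (risingℕ x k * (x + suc k)) ∎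
    where
    open ≡-Reasoning
    regroup : ∀ f P x k → suc (x + k) * (f * P) ≡ f * (P * (x + suc k))
    regroup = ℕ-Solver.solve-∀

  risingℕ-pos : ∀ x k → 0 < risingℕ x k
  risingℕ-pos x zero    = s≤s z≤n
  risingℕ-pos x (suc k) = ℕₚ.*-mono-≤ {1} {risingℕ x k} {1} {x + suc k} (risingℕ-pos x k)
                                      (subst (1 ≤_) (sym (ℕₚ.+-suc x k)) (s≤s z≤n))

  binomial-rising : ∀ c b r s → (((c + b) + (r + s)) C (b + r)) * risingℕ b r * risingℕ c s
                                ≡ ((c + b) C b) * risingℕ (c + b) (r + s)
  binomial-rising c b r s = ℕₚ.*-cancelˡ-≡ _ _ (b ! * c !) {{ℕₚ.m*n≢0 _ _ {{b ℕₚ.!≢0}} {{c ℕₚ.!≢0}}}} (begin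
      b ! * c ! * (X * risingℕ b r * risingℕ c s)
    ≡⟨ regroup₁ (b !) (c !) X (risingℕ b r) (risingℕ c s) ⟩
      X * ((b ! * risingℕ b r) * (c ! * risingℕ c s))
    ≡⟨ cong₂ (λ u v → X * (u * v)) (sym (!-rising b r)) (sym (!-rising c s)) ⟩
      X * ((b + r) ! * (c + s) !)
    ≡⟨ cong (λ m → (m C (b + r)) * ((b + r) ! * (c + s) !)) (sym top≡) ⟩
      (((c + s) + (b + r)) C (b + r)) * ((b + r) ! * (c + s) !)
    ≡⟨ binomial-factorials′ (c + s) (b + r) ⟩
      ((c + s) + (b + r)) !
    ≡⟨ cong _! top≡ ⟩
      ((c + b) + (r + s)) !
    ≡⟨ !-rising (c + b) (r + s) ⟩
      (c + b) ! * risingℕ (c + b) (r + s)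
    ≡⟨ cong (_* risingℕ (c + b) (r + s)) (sym (binomial-factorials′ c b)) ⟩
      ((c + b) C b) * (b ! * c !) * risingℕ (c + b) (r + s)
    ≡⟨ regroup₂ ((c + b) C b) (b !) (c !) (risingℕ (c + b) (r + s)) ⟩
      b ! * c ! * (((c + b) C b) * risingℕ (c + b) (r + s)) ∎)
    where
    open ≡-Reasoning
    X = ((c + b) + (r + s)) C (b + r)
    top≡ : (c + s) + (b + r) ≡ (c + b) + (r + s)
    top≡ = rearrange c s b r
      where
      rearrange : ∀ c s b r → (c + s) + (b + r) ≡ (c + b) + (r + s)
      rearrange = ℕ-Solver.solve-∀
    regroup₁ : ∀ B C X P Q → B * C * (X * P * Q) ≡ X * ((B * P) * (C * Q))
    regroup₁ = ℕ-Solver.solve-∀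
    regroup₂ : ∀ K B C P → K * (B * C) * P ≡ B * C * (K * P)
    regroup₂ = ℕ-Solver.solve-∀

  -- Case (b): the lower index exceeds b + n by t + 1, which is borrowed from the block c′ + t + 1.
  binomial-rising-overshoot : ∀ c′ t b n →
    (((c′ + suc t + b) + n) C (b + (n + suc t))) * risingℕ b (n + suc t)
    ≡ ((c′ + suc t + b) C b) * risingℕ (c′ + suc t + b) n * risingℕ c′ (suc t)
  binomial-rising-overshoot c′ t b n = ℕₚ.*-cancelˡ-≡ _ _ (b ! * c′ !) {{ℕₚ.m*n≢0 _ _ {{b ℕₚ.!≢0}} {{c′ ℕₚ.!≢0}}}} (begin
      b ! * c′ ! * (X * risingℕ b (n + suc t))
    ≡⟨ regroup₁ (b !) (c′ !) X (risingℕ b (n + suc t)) ⟩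
      X * ((b ! * risingℕ b (n + suc t)) * c′ !)
    ≡⟨ cong (λ u → X * (u * c′ !)) (sym (!-rising b (n + suc t))) ⟩
      X * ((b + (n + suc t)) ! * c′ !)
    ≡⟨ cong (λ m → (m C (b + (n + suc t))) * ((b + (n + suc t)) ! * c′ !)) (sym top≡) ⟩
      ((c′ + (b + (n + suc t))) C (b + (n + suc t))) * ((b + (n + suc t)) ! * c′ !)
    ≡⟨ binomial-factorials′ c′ (b + (n + suc t)) ⟩
      (c′ + (b + (n + suc t))) !
    ≡⟨ cong _! top≡ ⟩
      ((c′ + suc t + b) + n) !
    ≡⟨ !-rising (c′ + suc t + b) n ⟩
      (c′ + suc t + b) ! * risingℕ (c′ + suc t + b) n
    ≡⟨ cong (_* risingℕ (c′ + suc t + b) n) (sym (binomial-factorials′ (c′ + suc t) b)) ⟩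
      ((c′ + suc t + b) C b) * (b ! * (c′ + suc t) !) * risingℕ (c′ + suc t + b) n
    ≡⟨ cong (λ u → ((c′ + suc t + b) C b) * (b ! * u) * risingℕ (c′ + suc t + b) n) (!-rising c′ (suc t)) ⟩
      ((c′ + suc t + b) C b) * (b ! * (c′ ! * risingℕ c′ (suc t))) * risingℕ (c′ + suc t + b) n
    ≡⟨ regroup₂ ((c′ + suc t + b) C b) (b !) (c′ !) (risingℕ c′ (suc t)) (risingℕ (c′ + suc t + b) n) ⟩
      b ! * c′ ! * (((c′ + suc t + b) C b) * risingℕ (c′ + suc t + b) n * risingℕ c′ (suc t)) ∎)
    where
    open ≡-Reasoning
    X = ((c′ + suc t + b) + n) C (b + (n + suc t))
    top≡ : c′ + (b + (n + suc t)) ≡ (c′ + suc t + b) + n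
    top≡ = rearrange c′ t b n
      where
      rearrange : ∀ c t b n → c + (b + (n + suc t)) ≡ (c + suc t + b) + n
      rearrange = ℕ-Solver.solve-∀
    regroup₁ : ∀ B C X P → B * C * (X * P) ≡ X * ((B * P) * C)
    regroup₁ = ℕ-Solver.solve-∀
    regroup₂ : ∀ K B C Q P → K * (B * (C * Q)) * P ≡ B * C * (K * P * Q)
    regroup₂ = ℕ-Solver.solve-∀

module FactorialBlocks (q : ℕ) where
  open import Data.Nat using (_+_; _*_; _^_)
  open BigOperators using (∏<ℕ)
  open RisingProduct using (risingℕ)
  open Factorials

  p : ℕ
  p = suc q

  Φ : ℕ → ℕ
  Φ K = ∏ℕ[ m < K ] risingℕ (m * p) q

  Ψ : ℕ → ℕ → ℕ
  Ψ A K = ∏ℕ[ m < K ] risingℕ ((A + m) * p) q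

  Φ-pos : ∀ K → 0 < Φ K
  Φ-pos zero    = s≤s z≤n
  Φ-pos (suc K) = ℕₚ.*-mono-≤ {1} {Φ K} {1} {risingℕ (K * p) q} (Φ-pos K) (risingℕ-pos (K * p) q)

  !-blocks : ∀ M → (M * p) ! ≡ p ^ M * M ! * Φ M
  !-blocks zero    = refl
  !-blocks (suc M) = begin
      (p + M * p) !
    ≡⟨ cong _! (ℕₚ.+-comm p (M * p)) ⟩
      (M * p + suc q) !
    ≡⟨ !-rising (M * p) (suc q) ⟩
      (M * p) ! * (risingℕ (M * p) q * (M * p + suc q))
    ≡⟨ cong (λ u → u * (risingℕ (M * p) q * (M * p + suc q))) (!-blocks M) ⟩
      p ^ M * M ! * Φ M * (risingℕ (M * p) q * (M * p + suc q))
    ≡⟨ regroup (p ^ M) (M !) (Φ M) (risingℕ (M * p) q) M q ⟩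
      p * p ^ M * (M ! + M * M !) * (Φ M * risingℕ (M * p) q) ∎
    where
    open ≡-Reasoning
    regroup : ∀ P F G f M q → P * F * G * (f * (M * suc q + suc q)) ≡ suc q * P * (F + M * F) * (G * f)
    regroup = ℕ-Solver.solve-∀

  Φ-+ : ∀ A K → Φ (A + K) ≡ Φ A * Ψ A K
  Φ-+ A zero    = trans (cong Φ (ℕₚ.+-identityʳ A)) (sym (ℕₚ.*-identityʳ (Φ A)))
  Φ-+ A (suc K) = trans (cong Φ (ℕₚ.+-suc A K)) (trans (cong (_* risingℕ ((A + K) * p) q) (Φ-+ A K)) (ℕₚ.*-assoc (Φ A) _ _))

  binomial-blocks : ∀ A K → ((A * p + K * p) C (K * p)) * Φ K ≡ ((A + K) C K) * Ψ A K
  binomial-blocks A K = ℕₚ.*-cancelˡ-≡ _ _ c {{c≢0}} (begin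
      c * (X * Φ K)
    ≡⟨ regroup₁ (p ^ K) (K !) (p ^ A) (A !) (Φ A) X (Φ K) ⟩
      X * ((p ^ K * K ! * Φ K) * (p ^ A * A ! * Φ A))
    ≡⟨ cong₂ (λ u v → X * (u * v)) (sym (!-blocks K)) (sym (!-blocks A)) ⟩
      X * ((K * p) ! * (A * p) !)
    ≡⟨ binomial-factorials′ (A * p) (K * p) ⟩
      (A * p + K * p) !
    ≡⟨ cong _! (sym (ℕₚ.*-distribʳ-+ p A K)) ⟩
      ((A + K) * p) !
    ≡⟨ !-blocks (A + K) ⟩
      p ^ (A + K) * (A + K) ! * Φ (A + K)
    ≡⟨ cong₂ (λ u v → p ^ (A + K) * u * v) (sym (binomial-factorials′ A K)) (Φ-+ A K) ⟩
      p ^ (A + K) * (((A + K) C K) * (K ! * A !)) * (Φ A * Ψ A K)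
    ≡⟨ cong (λ u → u * (((A + K) C K) * (K ! * A !)) * (Φ A * Ψ A K)) (ℕₚ.^-distribˡ-+-* p A K) ⟩
      p ^ A * p ^ K * (((A + K) C K) * (K ! * A !)) * (Φ A * Ψ A K)
    ≡⟨ regroup₂ (p ^ K) (K !) (p ^ A) (A !) (Φ A) ((A + K) C K) (Ψ A K) ⟩
      c * (((A + K) C K) * Ψ A K) ∎)
    where
    open ≡-Reasoning
    X = (A * p + K * p) C (K * p)
    c = p ^ K * K ! * p ^ A * A ! * Φ A
    instance
      c≢0 : NonZero c
      c≢0 = ℕₚ.m*n≢0 _ _ {{ℕₚ.m*n≢0 _ _ {{ℕₚ.m*n≢0 _ _ {{ℕₚ.m*n≢0 _ _ {{ℕₚ.m^n≢0 p K}} {{K ℕₚ.!≢0}}}} {{ℕₚ.m^n≢0 p A}}}}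
              {{A ℕₚ.!≢0}}}} {{ℕ.>-nonZero (Φ-pos A)}}
    regroup₁ : ∀ a b c d e X f → a * b * c * d * e * (X * f) ≡ X * ((a * b * f) * (c * d * e))
    regroup₁ = ℕ-Solver.solve-∀
    regroup₂ : ∀ a b c d e C Ψ → c * a * (C * (b * d)) * (e * Ψ) ≡ a * b * c * d * e * (C * Ψ)
    regroup₂ = ℕ-Solver.solve-∀

  Φ₃ : ℕ → ℕ
  Φ₃ R = Φ R * Φ (R * p) * Φ (R * p * p)

  Ψ₃ : ℕ → ℕ → ℕ
  Ψ₃ d R = Ψ d R * Ψ (d * p) (R * p) * Ψ (d * p * p) (R * p * p)

  binomial-p³-blocks : ∀ d R → ((d * p * p * p + R * p * p * p) C (R * p * p * p)) * Φ₃ R ≡ ((d + R) C R) * Ψ₃ d R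
  binomial-p³-blocks d R = begin
      X₃ * (Φ R * Φ (R * p) * Φ (R * p * p))
    ≡⟨ regroup₁ X₃ (Φ R) (Φ (R * p)) (Φ (R * p * p)) ⟩
      X₃ * Φ (R * p * p) * Φ (R * p) * Φ R
    ≡⟨ cong (λ u → u * Φ (R * p) * Φ R) (binomial-blocks (d * p * p) (R * p * p)) ⟩
      X₂ * Ψ (d * p * p) (R * p * p) * Φ (R * p) * Φ R
    ≡⟨ regroup₂ X₂ (Ψ (d * p * p) (R * p * p)) (Φ (R * p)) (Φ R) ⟩
      X₂ * Φ (R * p) * Φ R * Ψ (d * p * p) (R * p * p)
    ≡⟨ cong (λ u → u * Φ R * Ψ (d * p * p) (R * p * p)) (binomial-blocks (d * p) (R * p)) ⟩
      X₁ * Ψ (d * p) (R * p) * Φ R * Ψ (d * p * p) (R * p * p)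
    ≡⟨ regroup₂ X₁ (Ψ (d * p) (R * p)) (Φ R) (Ψ (d * p * p) (R * p * p)) ⟩
      X₁ * Φ R * Ψ (d * p * p) (R * p * p) * Ψ (d * p) (R * p)
    ≡⟨ cong (λ u → u * Ψ (d * p * p) (R * p * p) * Ψ (d * p) (R * p)) (binomial-blocks d R) ⟩
      ((d + R) C R) * Ψ d R * Ψ (d * p * p) (R * p * p) * Ψ (d * p) (R * p)
    ≡⟨ regroup₃ ((d + R) C R) (Ψ d R) (Ψ (d * p * p) (R * p * p)) (Ψ (d * p) (R * p)) ⟩
      ((d + R) C R) * (Ψ d R * Ψ (d * p) (R * p) * Ψ (d * p * p) (R * p * p)) ∎
    where
    open ≡-Reasoning
    X₃ = (d * p * p * p + R * p * p * p) C (R * p * p * p)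
    X₂ = (d * p * p + R * p * p) C (R * p * p)
    X₁ = (d * p + R * p) C (R * p)
    regroup₁ : ∀ x a b c → x * (a * b * c) ≡ x * c * b * a
    regroup₁ = ℕ-Solver.solve-∀
    regroup₂ : ∀ x a b c → x * a * b * c ≡ x * b * c * a
    regroup₂ = ℕ-Solver.solve-∀
    regroup₃ : ∀ x a b c → x * a * b * c ≡ x * (a * c * b)
    regroup₃ = ℕ-Solver.solve-∀

module BlockCongruences {q} (p-prime : Prime (suc q)) (6≤q : 6 ≤ q) (w : ℕ)
                        (H1≡w : CongModPow (suc q) 2 (H1 q ℚ.* (1 ÷ℕ (suc q ℕ.^ 2))) (ℕtoℚ w)) where
  open import Data.Integer using (_+_; _*_; 1ℤ)
  open Congruence
  open BigOperators
  open RisingProduct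
  open PrimeDivisibility p-prime
  open RisingAtMultiplesW p-prime 6≤q w H1≡w public
  open FactorialBlocks q public

  pos-Ψ : ∀ A K → + Ψ A K ≡ ∏[ m < K ] F (+ A + + m)
  pos-Ψ A K = trans (pos-∏ K _) (∏-cong K (λ m → trans (pos-rising ((A ℕ.+ m) ℕ.* p) q)
    (cong (λ x → rising x q) (trans (ℤₚ.pos-* (A ℕ.+ m) p) (cong (_* π) (ℤₚ.pos-+ A m))))))

  pos-Φ : ∀ K → + Φ K ≡ ∏[ m < K ] F (+ m)
  pos-Φ K = trans (pos-∏ K _) (∏-cong K (λ m → trans (pos-rising (m ℕ.* p) q) (cong (λ x → rising x q) (ℤₚ.pos-* m p))))

  Ψ-mod-π⁵ : ∀ A K → + Ψ A K ≡ + Φ K * (1ℤ + c₃ * (+ A * + K * (+ A + + K))) mod π⁵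
  Ψ-mod-π⁵ A K = subst₂ (λ u v → u ≡ v * (1ℤ + c₃ * (+ A * + K * (+ A + + K))) mod π⁵)
                        (sym (pos-Ψ A K)) (sym (pos-Φ K)) (∏F-shift (+ A) K)

  -- At the higher levels A K (A + K) carries a further factor p³.
  Ψ-p-mod-π⁵ : ∀ A K → + Ψ (A ℕ.* p) (K ℕ.* p) ≡ + Φ (K ℕ.* p) mod π⁵
  Ψ-p-mod-π⁵ A K = mod-trans (Ψ-mod-π⁵ (A ℕ.* p) (K ℕ.* p))
    (subst₂ (λ a k → Y * (1ℤ + c₃ * (a * k * (a + k))) ≡ Y mod π⁵) (sym (ℤₚ.pos-* A p)) (sym (ℤₚ.pos-* K p))
      (mod-sym (by-π⁵ (ℤ.- (Y * + w * π * (+ A * + K * (+ A + + K)))) (expand Y (+ w) π (+ A) (+ K)))))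
    where
    Y = + Φ (K ℕ.* p)
    expand : ∀ Y w π a k → Y ≡ Y * (1ℤ + w * (π * π * π) * (a * π * (k * π) * (a * π + k * π)))
                                 + ℤ.- (Y * w * π * (a * k * (a + k))) * (π * π * π * π * π)
    expand = solve-∀

  Ψ₃-mod-π⁵ : ∀ d R → + Ψ₃ d R ≡ + Φ₃ R * (1ℤ + c₃ * (+ d * + R * (+ d + + R))) mod π⁵
  Ψ₃-mod-π⁵ d R = begin
      + Ψ₃ d R
    ≡⟨ trans (ℤₚ.pos-* (Ψ d R ℕ.* Ψ (d ℕ.* p) (R ℕ.* p)) _)
             (cong (_* + Ψ (d ℕ.* p ℕ.* p) (R ℕ.* p ℕ.* p)) (ℤₚ.pos-* (Ψ d R) _)) ⟩
      + Ψ d R * + Ψ (d ℕ.* p) (R ℕ.* p) * + Ψ (d ℕ.* p ℕ.* p) (R ℕ.* p ℕ.* p)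
    ≈⟨ mod-* (mod-* (Ψ-mod-π⁵ d R) (Ψ-p-mod-π⁵ d R)) (Ψ-p-mod-π⁵ (d ℕ.* p) (R ℕ.* p)) ⟩
      + Φ R * e * + Φ (R ℕ.* p) * + Φ (R ℕ.* p ℕ.* p)
    ≡⟨ trans (regroup (+ Φ R) (+ Φ (R ℕ.* p)) (+ Φ (R ℕ.* p ℕ.* p)) e)
             (cong (_* e) (sym (trans (ℤₚ.pos-* (Φ R ℕ.* Φ (R ℕ.* p)) _) (cong (_* + Φ (R ℕ.* p ℕ.* p)) (ℤₚ.pos-* (Φ R) _))))) ⟩
      + Φ₃ R * e ∎
    where
    open mod-Reasoning π⁵
    e = 1ℤ + c₃ * (+ d * + R * (+ d + + R))
    regroup : ∀ a b c e → a * e * b * c ≡ a * b * c * e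
    regroup = solve-∀

module FractionCongruence where
  open import Data.Integer using (_+_; _*_; -_; _^_)
  open Congruence
  open Fraction
  open BigOperators using (pos-^)

  ÷-cross : ∀ {x a b a′ m} → x ≐ a ÷ b → a * + m ≡ a′ * b → 0 < m → x ≐ a′ ÷ + m
  ÷-cross {a = a} {a′ = a′} {m = suc m} (fraction n refl refl) eq _ = fraction m refl (/-≡ a n a′ m eq)

  congModPow-÷ : ∀ {p k x y a b c d} → x ≐ a ÷ b → y ≐ c ÷ d → ¬ p ∣ ∣ b * d ∣ →
                 a * d ≡ c * b mod (+ p) ^ k → CongModPow p k x y
  congModPow-÷ {p} {k} {x} {y} {a} {b} {c} {d} x≐ y≐ p∤bd (M , ad≡) = witness (÷-* x≐ y≐)
    where
    P = + (p ℕ.^ k)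
    cancel : ∀ c b v w → (c * b + v + - c * b) * (w * + 1) ≡ v * w
    cancel = solve-∀
    witness : ∀ {xy} → xy ≐ a * c ÷ b * d → CongModPow p k x y
    witness (fraction e bd≡ _) = M / suc e , pIntegral-/ M e (subst (λ n → ¬ p ∣ ∣ n ∣) bd≡ p∤bd) ,
      ÷-≡ (÷-- x≐ y≐) (÷-* (÷-/ M e) (÷-ℕ (p ℕ.^ k))) (begin
        (a * d + - c * b) * (+ suc e * + 1)        ≡⟨ cong₂ (λ u v → (u + - c * b) * (v * + 1)) ad≡ (sym bd≡) ⟩
        (c * b + M * (+ p) ^ k + - c * b) * (b * d * + 1) ≡⟨ cancel c b (M * (+ p) ^ k) (b * d) ⟩
        M * (+ p) ^ k * (b * d)                     ≡⟨ cong (λ u → M * u * (b * d)) (sym (pos-^ p k)) ⟩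
        M * P * (b * d) ∎)
      where
      open ≡-Reasoning

module RisingLinear where
  open import Data.Integer using (_+_; _*_)
  open Congruence
  open RisingProduct
  open Harmonic

  rising-linear : ∀ x k → rising x k ≡ + (k !) + x * harmonicNumerator k mod x * x
  rising-linear x zero    = mod-reflexive (solve (x ∷ []))
  rising-linear x (suc k) = begin
      rising x k * (x + + suc k)
    ≈⟨ mod-*ʳ (x + + suc k) (rising-linear x k) ⟩
      (+ (k !) + x * harmonicNumerator k) * (x + + suc k)
    ≈⟨ harmonicNumerator k , expand (+ (k !)) (harmonicNumerator k) x (+ suc k) ⟩
      + (k !) * + suc k + x * (harmonicNumerator k * + suc k + + (k !))
    ≡⟨ cong (_+ x * harmonicNumerator (suc k)) (sym (pos-! k)) ⟩
      + (suc k !) + x * harmonicNumerator (suc k) ∎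
    where
    open mod-Reasoning (x * x)
    expand : ∀ f h x c → (f + x * h) * (x + c) ≡ f * c + x * (h * c + f) + h * (x * x)
    expand = solve-∀

module RightHandSides where
  open import Data.Integer using (_+_; _*_; -_; _-_)
  open import Data.Rational using () renaming (_+_ to _+ℚ_; _-_ to _-ℚ_; _*_ to _*ℚ_)
  open Fraction

  ÷-rhs-a : ∀ {hn hr hs nq rq wq dq pq Hn Hr Hs Fn Fr Fs N R w d P} →
            hn ≐ Hn ÷ Fn → hr ≐ Hr ÷ Fr → hs ≐ Hs ÷ Fs →
            nq ≐ N ÷ + 1 → rq ≐ R ÷ + 1 → wq ≐ w ÷ + 1 → dq ≐ d ÷ + 1 → pq ≐ P ÷ + 1 →
            ℕtoℚ 1 +ℚ (((hn *ℚ nq) -ℚ (hr *ℚ rq)) +ℚ (((wq *ℚ nq) *ℚ rq) -ℚ hs) *ℚ dq) *ℚ pq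
            ≐ Fn * Fr * Fs + P * (Hn * N * Fr * Fs - Hr * R * Fn * Fs + (w * N * R * Fs - Hs) * d * Fn * Fr)
            ÷ Fn * Fr * Fs
  ÷-rhs-a {Hn = Hn} {Hr} {Hs} {Fn} {Fr} {Fs} {N} {R} {w} {d} {P} hn≐ hr≐ hs≐ nq≐ rq≐ wq≐ dq≐ pq≐ =
    ÷-reshape (÷-+ (÷-ℕ 1) (÷-* (÷-+ (÷-- (÷-* hn≐ nq≐) (÷-* hr≐ rq≐))
                                      (÷-* (÷-- (÷-* (÷-* wq≐ nq≐) rq≐) hs≐) dq≐)) pq≐))
               (solve (Hn ∷ Hr ∷ Hs ∷ Fn ∷ Fr ∷ Fs ∷ N ∷ R ∷ w ∷ d ∷ P ∷ [])) (solve (Fn ∷ Fr ∷ Fs ∷ []))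

  ÷-rhs-b : ∀ {sq dq pq S d D P} → sq ≐ S ÷ + 1 → dq ≐ d ÷ D → pq ≐ P ÷ + 1 → (sq *ℚ dq) *ℚ pq ≐ S * d * P ÷ D
  ÷-rhs-b {S = S} {d} {D} {P} sq≐ dq≐ pq≐ = ÷-reshape (÷-* (÷-* sq≐ dq≐) pq≐) (solve (S ∷ d ∷ P ∷ [])) (solve (D ∷ []))

module CommonSetting {q} (p-prime : Prime (suc q)) (6≤q : 6 ≤ q) (w : ℕ)
                     (H1≡w : CongModPow (suc q) 2 (H1 q ℚ.* (1 ÷ℕ (suc q ℕ.^ 2))) (ℕtoℚ w)) where
  open import Data.Integer using (_+_; _*_; 1ℤ)
  open Congruence
  open BigOperators
  open RisingProduct
  open Harmonic
  open RisingLinear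
  open PrimeDivisibility p-prime public
  open BlockCongruences p-prime 6≤q w H1≡w public

  P³ : ℤ
  P³ = π * π * π

  pos-p³ : ∀ x → + (x ℕ.* p ℕ.* p ℕ.* p) ≡ P³ * + x
  pos-p³ x = trans (ℤₚ.pos-* (x ℕ.* p ℕ.* p) p)
               (trans (cong (_* π) (trans (ℤₚ.pos-* (x ℕ.* p) p) (cong (_* π) (ℤₚ.pos-* x p)))) (rotate (+ x) π))
    where
    rotate : ∀ x p → x * p * p * p ≡ p * p * p * x
    rotate = solve-∀

  pos-p^3 : + (p ℕ.^ 3) ≡ P³
  pos-p^3 = trans (pos-^ p 3) (unfold π)
    where
    unfold : ∀ x → x * (x * (x * 1ℤ)) ≡ x * x * x
    unfold = solve-∀

  p∣p³ : ∀ x → p ∣ x ℕ.* p ℕ.* p ℕ.* p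
  p∣p³ x = divides (x ℕ.* p ℕ.* p) refl

  rising-p³ : ∀ y k → rising (P³ * y) k ≡ + (k !) + P³ * (y * harmonicNumerator k) mod π⁵
  rising-p³ y k = mod-trans (mod-divisor (π * y * y) square (rising-linear (P³ * y) k))
                            (mod-reflexive (cong (λ u → + (k !) + u) (ℤₚ.*-assoc P³ y (harmonicNumerator k))))
    where
    split : ∀ π y → π * π * π * y * (π * π * π * y) ≡ π * π * π * π * π * (π * y * y)
    split = solve-∀
    square : P³ * y * (P³ * y) ≡ π⁵ * (π * y * y)
    square = trans (split π y) (cong (_* (π * y * y)) (sym π⁵-unfold))

  rising-p³ℕ : ∀ x k → + risingℕ (x ℕ.* p ℕ.* p ℕ.* p) k ≡ + (k !) + P³ * (+ x * harmonicNumerator k) mod π⁵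
  rising-p³ℕ x k = subst (λ u → u ≡ + (k !) + P³ * (+ x * harmonicNumerator k) mod π⁵)
                         (sym (trans (pos-rising _ k) (cong (λ u → rising u k) (pos-p³ x)))) (rising-p³ (+ x) k)

  rising-p³-sum : ∀ x y k → + risingℕ (x ℕ.* p ℕ.* p ℕ.* p ℕ.+ y ℕ.* p ℕ.* p ℕ.* p) k
                            ≡ + (k !) + P³ * ((+ x + + y) * harmonicNumerator k) mod π⁵
  rising-p³-sum x y k = subst (λ u → u ≡ + (k !) + P³ * ((+ x + + y) * harmonicNumerator k) mod π⁵)
                              (sym (trans (pos-rising _ k) (cong (λ u → rising u k) sum≡))) (rising-p³ (+ x + + y) k)
    where
    sum≡ : + (x ℕ.* p ℕ.* p ℕ.* p ℕ.+ y ℕ.* p ℕ.* p ℕ.* p) ≡ P³ * (+ x + + y)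
    sum≡ = trans (ℤₚ.pos-+ (x ℕ.* p ℕ.* p ℕ.* p) (y ℕ.* p ℕ.* p ℕ.* p))
                 (trans (cong₂ _+_ (pos-p³ x) (pos-p³ y)) (sym (ℤₚ.*-distribˡ-+ P³ (+ x) (+ y))))

  first-order-product : ∀ a x b y → (a + P³ * x) * (b + P³ * y) ≡ a * b + P³ * (a * y + x * b) mod π⁵
  first-order-product a x b y = by-π⁵ (π * x * y) (expand a x b y π)
    where
    expand : ∀ a x b y π → (a + π * π * π * x) * (b + π * π * π * y)
                           ≡ a * b + π * π * π * (a * y + x * b) + π * x * y * (π * π * π * π * π)
    expand = solve-∀

  p∤Φ : ∀ K → ¬ p ∣ Φ K
  p∤Φ K = p∤∏ K (λ m → p∤rising q (divides m refl) (ℕₚ.n<1+n q))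

  p∤Φ₃ : ∀ R → ¬ p ∣ Φ₃ R
  p∤Φ₃ R = p∤* (p∤* (p∤Φ R) (p∤Φ (R ℕ.* p))) (p∤Φ (R ℕ.* p ℕ.* p))

  p∤⇒pos : ∀ {m} → ¬ p ∣ m → 0 < m
  p∤⇒pos {zero}  p∤0 = ⊥-elim (p∤0 (divides 0 refl))
  p∤⇒pos {suc m} _   = s≤s z≤n

module PartA {q} (p-prime : Prime (suc q)) (6≤q : 6 ≤ q) (w : ℕ)
             (H1≡w : CongModPow (suc q) 2 (H1 q ℚ.* (1 ÷ℕ (suc q ℕ.^ 2))) (ℕtoℚ w))
             (N R n r : ℕ) (R≤N : R ≤ N) (r≤n : r ≤ n) (n<p : n < suc q) where
  open import Data.Integer using (_+_; _*_; -_; _-_; 1ℤ)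
  open import Data.Rational using () renaming (_+_ to _+ℚ_; _-_ to _-ℚ_; _*_ to _*ℚ_)
  open Congruence
  open Fraction
  open RisingProduct
  open Harmonic
  open Factorials
  open FractionCongruence
  open RightHandSides
  open CommonSetting p-prime 6≤q w H1≡w

  d = N ℕ.∸ R
  s = n ℕ.∸ r
  c = d ℕ.* p ℕ.* p ℕ.* p
  b = R ℕ.* p ℕ.* p ℕ.* p
  A = (N ℕ.* p ℕ.^ 3 ℕ.+ n) C (R ℕ.* p ℕ.^ 3 ℕ.+ r)
  Pa = risingℕ (c ℕ.+ b) n
  Pb = risingℕ b r
  Pc = risingℕ c s

  LHS RHS : ℚ
  LHS = A ÷ℕ ((N C R) ℕ.* (n C r))
  RHS = ℕtoℚ 1 +ℚ (((H1 n *ℚ ℕtoℚ N) -ℚ (H1 r *ℚ ℕtoℚ R))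
                  +ℚ (((ℕtoℚ w *ℚ ℕtoℚ N) *ℚ ℕtoℚ R) -ℚ H1 (n ℕ.∸ r)) *ℚ ℕtoℚ (N ℕ.∸ R))
                *ℚ ℕtoℚ (p ℕ.^ 3)

  d+R≡N : d ℕ.+ R ≡ N
  d+R≡N = ℕₚ.m∸n+n≡m R≤N

  r+s≡n : r ℕ.+ s ≡ n
  r+s≡n = ℕₚ.m+[n∸m]≡n r≤n

  A≡ : A ≡ ((c ℕ.+ b) ℕ.+ (r ℕ.+ s)) C (b ℕ.+ r)
  A≡ = cong₂ _C_ (trans (cong₂ (λ u v → u ℕ.* p ℕ.^ 3 ℕ.+ v) (sym d+R≡N) (sym r+s≡n)) (expand d R p r s)) (expand′ R p r)
    where
    expand : ∀ d R p r s → (d ℕ.+ R) ℕ.* (p ℕ.* (p ℕ.* (p ℕ.* 1))) ℕ.+ (r ℕ.+ s)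
                          ≡ (d ℕ.* p ℕ.* p ℕ.* p ℕ.+ R ℕ.* p ℕ.* p ℕ.* p) ℕ.+ (r ℕ.+ s)
    expand = ℕ-Solver.solve-∀
    expand′ : ∀ R p r → R ℕ.* (p ℕ.* (p ℕ.* (p ℕ.* 1))) ℕ.+ r ≡ R ℕ.* p ℕ.* p ℕ.* p ℕ.+ r
    expand′ = ℕ-Solver.solve-∀

  binomial-identity : A ℕ.* (Pb ℕ.* Pc ℕ.* Φ₃ R) ≡ (N C R) ℕ.* (Ψ₃ d R ℕ.* Pa)
  binomial-identity = begin
      A ℕ.* (Pb ℕ.* Pc ℕ.* Φ₃ R)
    ≡⟨ cong (λ u → u ℕ.* (Pb ℕ.* Pc ℕ.* Φ₃ R)) A≡ ⟩
      A′ ℕ.* (Pb ℕ.* Pc ℕ.* Φ₃ R)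
    ≡⟨ regroup₁ A′ Pb Pc (Φ₃ R) ⟩
      A′ ℕ.* Pb ℕ.* Pc ℕ.* Φ₃ R
    ≡⟨ cong (ℕ._* Φ₃ R) (binomial-rising c b r s) ⟩
      ((c ℕ.+ b) C b) ℕ.* risingℕ (c ℕ.+ b) (r ℕ.+ s) ℕ.* Φ₃ R
    ≡⟨ regroup₂ ((c ℕ.+ b) C b) (risingℕ (c ℕ.+ b) (r ℕ.+ s)) (Φ₃ R) ⟩
      ((c ℕ.+ b) C b) ℕ.* Φ₃ R ℕ.* risingℕ (c ℕ.+ b) (r ℕ.+ s)
    ≡⟨ cong₂ ℕ._*_ (binomial-p³-blocks d R) (cong (risingℕ (c ℕ.+ b)) r+s≡n) ⟩
      ((d ℕ.+ R) C R) ℕ.* Ψ₃ d R ℕ.* Pa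
    ≡⟨ cong (λ m → (m C R) ℕ.* Ψ₃ d R ℕ.* Pa) d+R≡N ⟩
      (N C R) ℕ.* Ψ₃ d R ℕ.* Pa
    ≡⟨ ℕₚ.*-assoc (N C R) (Ψ₃ d R) Pa ⟩
      (N C R) ℕ.* (Ψ₃ d R ℕ.* Pa) ∎
    where
    open ≡-Reasoning
    A′ = ((c ℕ.+ b) ℕ.+ (r ℕ.+ s)) C (b ℕ.+ r)
    regroup₁ : ∀ a x y z → a ℕ.* (x ℕ.* y ℕ.* z) ≡ a ℕ.* x ℕ.* y ℕ.* z
    regroup₁ = ℕ-Solver.solve-∀
    regroup₂ : ∀ x y z → x ℕ.* y ℕ.* z ≡ x ℕ.* z ℕ.* y
    regroup₂ = ℕ-Solver.solve-∀

  n! r! s! V U e₀ : ℤ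
  n! = + (n !)
  r! = + (r !)
  s! = + (s !)
  V = + Φ₃ R
  U = + Ψ₃ d R
  e₀ = + d * + R * (+ d + + R)

  U·Pa-mod : U * + Pa ≡ V * n! + P³ * (V * ((+ d + + R) * harmonicNumerator n) + V * + w * e₀ * n!) mod π⁵
  U·Pa-mod = mod-trans (mod-* U-mod (rising-p³-sum d R n)) (first-order-product V (V * + w * e₀) n! ((+ d + + R) * harmonicNumerator n))
    where
    U-mod : U ≡ V + P³ * (V * + w * e₀) mod π⁵
    U-mod = mod-trans (Ψ₃-mod-π⁵ d R) (mod-reflexive (expand V (+ w) π e₀))
      where
      expand : ∀ V w π e → V * (1ℤ + w * (π * π * π) * e) ≡ V + π * π * π * (V * w * e)
      expand = solve-∀

  Pb·Pc·V-mod : + Pb * + Pc * V ≡ (r! * s! + P³ * (r! * (+ d * harmonicNumerator s) + + R * harmonicNumerator r * s!)) * V mod π⁵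
  Pb·Pc·V-mod = mod-*ʳ V (mod-trans (mod-* (rising-p³ℕ R r) (rising-p³ℕ d s))
                                    (first-order-product r! (+ R * harmonicNumerator r) s! (+ d * harmonicNumerator s)))

  numerator : ℤ → ℤ → ℤ
  numerator Nz P = n! * r! * s! + P * (harmonicNumerator n * Nz * r! * s! - harmonicNumerator r * + R * n! * s!
                                       + (+ w * Nz * + R * s! - harmonicNumerator s) * + d * n! * r!)

  -- The first-order terms on both sides agree identically, and the second-order ones carry p⁶.
  first-order-agreement : ∀ V Fn Fr Fs Hn Hr Hs d R w π →
    let P = π * π * π
        α = V * ((d + R) * Hn) + V * w * (d * R * (d + R)) * Fn
        β = Fr * (d * Hs) + R * Hr * Fs
        γ = Hn * (d + R) * Fr * Fs - Hr * R * Fn * Fs + (w * (d + R) * R * Fs - Hs) * d * Fn * Fr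
    in (V * Fn + P * α) * (Fr * Fs) * (Fn * Fr * Fs)
       ≡ (Fr * Fs + P * β) * V * Fn * (Fn * Fr * Fs + P * γ) + - (π * β * V * Fn * γ) * (π * π * π * π * π)
  first-order-agreement = solve-∀

  α β γ : ℤ
  α = V * ((+ d + + R) * harmonicNumerator n) + V * + w * e₀ * n!
  β = r! * (+ d * harmonicNumerator s) + + R * harmonicNumerator r * s!
  γ = harmonicNumerator n * (+ d + + R) * r! * s! - harmonicNumerator r * + R * n! * s!
      + (+ w * (+ d + + R) * + R * s! - harmonicNumerator s) * + d * n! * r!

  core : U * + Pa * (r! * s!) * (n! * r! * s!) ≡ + Pb * + Pc * V * n! * numerator (+ N) (+ (p ℕ.^ 3)) mod π⁵
  core = begin
      U * + Pa * (r! * s!) * (n! * r! * s!)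
    ≈⟨ mod-*ʳ (n! * r! * s!) (mod-*ʳ (r! * s!) U·Pa-mod) ⟩
      (V * n! + P³ * α) * (r! * s!) * (n! * r! * s!)
    ≈⟨ by-π⁵ (- (π * β * V * n! * γ))
             (first-order-agreement V n! r! s! (harmonicNumerator n) (harmonicNumerator r) (harmonicNumerator s) (+ d) (+ R) (+ w) π) ⟩
      (r! * s! + P³ * β) * V * n! * numerator (+ d + + R) P³
    ≈⟨ mod-*ʳ (numerator (+ d + + R) P³) (mod-*ʳ n! (mod-sym Pb·Pc·V-mod)) ⟩
      + Pb * + Pc * V * n! * numerator (+ d + + R) P³
    ≡⟨ cong₂ (λ u v → + Pb * + Pc * V * n! * numerator u v)
             (trans (sym (ℤₚ.pos-+ d R)) (cong +_ d+R≡N)) (sym pos-p^3) ⟩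
      + Pb * + Pc * V * n! * numerator (+ N) (+ (p ℕ.^ 3)) ∎
    where
    open mod-Reasoning π⁵

  G = Pb ℕ.* Pc ℕ.* Φ₃ R

  p∤G·n! : ¬ p ∣ G ℕ.* n !
  p∤G·n! = p∤* (p∤* (p∤* (p∤rising r (p∣p³ R) (ℕₚ.≤-<-trans r≤n n<p))
                          (p∤rising s (p∣p³ d) (ℕₚ.≤-<-trans (ℕₚ.m∸n≤m n r) n<p)))
                    (p∤Φ₃ R))
               (p∤! n<p)

  lhs≐ : LHS ≐ + (Ψ₃ d R ℕ.* Pa ℕ.* (r ! ℕ.* s !)) ÷ + (G ℕ.* n !)
  lhs≐ = ÷-cross (÷-÷ℕ A (ℕₚ.*-mono-≤ {1} {N C R} {1} {n C r} (C-pos R≤N) (C-pos r≤n)))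
                 (trans (sym (ℤₚ.pos-* A _)) (trans (cong +_ cleared) (ℤₚ.pos-* (Ψ₃ d R ℕ.* Pa ℕ.* (r ! ℕ.* s !)) ((N C R) ℕ.* (n C r)))))
                 (p∤⇒pos p∤G·n!)
    where
    cleared : A ℕ.* (G ℕ.* n !) ≡ Ψ₃ d R ℕ.* Pa ℕ.* (r ! ℕ.* s !) ℕ.* ((N C R) ℕ.* (n C r))
    cleared = begin
        A ℕ.* (G ℕ.* n !)
      ≡⟨ sym (ℕₚ.*-assoc A G (n !)) ⟩
        A ℕ.* G ℕ.* n !
      ≡⟨ cong₂ ℕ._*_ binomial-identity (sym (binomial-factorials r≤n)) ⟩
        (N C R) ℕ.* (Ψ₃ d R ℕ.* Pa) ℕ.* ((n C r) ℕ.* (r ! ℕ.* s !))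
      ≡⟨ regroup (N C R) (Ψ₃ d R ℕ.* Pa) (n C r) (r ! ℕ.* s !) ⟩
        Ψ₃ d R ℕ.* Pa ℕ.* (r ! ℕ.* s !) ℕ.* ((N C R) ℕ.* (n C r)) ∎
      where
      open ≡-Reasoning
      regroup : ∀ a x b y → a ℕ.* x ℕ.* (b ℕ.* y) ≡ x ℕ.* y ℕ.* (a ℕ.* b)
      regroup = ℕ-Solver.solve-∀

  rhs≐ : RHS ≐ numerator (+ N) (+ (p ℕ.^ 3)) ÷ n! * r! * s!
  rhs≐ = ÷-rhs-a (÷-H1 n) (÷-H1 r) (÷-H1 s) (÷-ℕ N) (÷-ℕ R) (÷-ℕ w) (÷-ℕ d) (÷-ℕ (p ℕ.^ 3))

  partA : CongModPow p 5 LHS RHS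
  partA = congModPow-÷ {k = 5} lhs≐ rhs≐ p∤denominators (begin
      + (Ψ₃ d R ℕ.* Pa ℕ.* (r ! ℕ.* s !)) * (n! * r! * s!)
    ≡⟨ cong (_* (n! * r! * s!)) (trans (ℤₚ.pos-* (Ψ₃ d R ℕ.* Pa) _) (cong₂ _*_ (ℤₚ.pos-* (Ψ₃ d R) Pa) (ℤₚ.pos-* (r !) (s !)))) ⟩
      U * + Pa * (r! * s!) * (n! * r! * s!)
    ≈⟨ core ⟩
      + Pb * + Pc * V * n! * numerator (+ N) (+ (p ℕ.^ 3))
    ≡⟨ trans (ℤₚ.*-comm _ (numerator (+ N) (+ (p ℕ.^ 3))))
             (cong (numerator (+ N) (+ (p ℕ.^ 3)) *_) (sym (trans (ℤₚ.pos-* G (n !))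
               (cong (_* n!) (trans (ℤₚ.pos-* (Pb ℕ.* Pc) (Φ₃ R)) (cong (_* V) (ℤₚ.pos-* Pb Pc))))))) ⟩
      numerator (+ N) (+ (p ℕ.^ 3)) * + (G ℕ.* n !) ∎)
    where
    open mod-Reasoning π⁵
    p∤denominators : ¬ p ∣ ∣ + (G ℕ.* n !) * (n! * r! * s!) ∣
    p∤denominators = subst (λ m → ¬ p ∣ ∣ m ∣)
      (sym (trans (cong (+ (G ℕ.* n !) *_) (trans (cong (_* s!) (sym (ℤₚ.pos-* (n !) (r !)))) (sym (ℤₚ.pos-* (n ! ℕ.* r !) (s !)))))
                  (sym (ℤₚ.pos-* (G ℕ.* n !) _))))
      (p∤* p∤G·n! (p∤* (p∤* (p∤! n<p) (p∤! (ℕₚ.≤-<-trans r≤n n<p))) (p∤! (ℕₚ.≤-<-trans (ℕₚ.m∸n≤m n r) n<p))))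

module PartB {q} (p-prime : Prime (suc q)) (6≤q : 6 ≤ q) (w : ℕ)
             (H1≡w : CongModPow (suc q) 2 (H1 q ℚ.* (1 ÷ℕ (suc q ℕ.^ 2))) (ℕtoℚ w))
             (N R n r : ℕ) (R≤N : R ≤ N) (n<r : n < r) (r<p : r < suc q) where
  open import Data.Integer using (_+_; _*_; -_; 0ℤ; 1ℤ)
  open import Data.Rational using () renaming (_*_ to _*ℚ_)
  open import Data.Nat.Combinatorics using (nCn≡1)
  open Congruence
  open Fraction
  open RisingProduct
  open Reflection
  open Harmonic
  open Factorials
  open FractionCongruence
  open RightHandSides
  open CommonSetting p-prime 6≤q w H1≡w

  d = N ℕ.∸ R
  k = r ℕ.∸ suc n
  c = d ℕ.* p ℕ.* p ℕ.* p
  b = R ℕ.* p ℕ.* p ℕ.* p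
  A = (N ℕ.* p ℕ.^ 3 ℕ.+ n) C (R ℕ.* p ℕ.^ 3 ℕ.+ r)
  Den = r ℕ.* ((r ℕ.∸ 1) C n)

  LHS RHS : ℚ
  LHS = A ÷ℕ (N C R)
  RHS = (sgn (r ℕ.∸ n ℕ.+ 1) *ℚ ((N ℕ.∸ R) ÷ℕ Den)) *ℚ ℕtoℚ (p ℕ.^ 3)

  d+R≡N : d ℕ.+ R ≡ N
  d+R≡N = ℕₚ.m∸n+n≡m R≤N

  n+k+1≡r : n ℕ.+ suc k ≡ r
  n+k+1≡r = trans (ℕₚ.+-suc n k) (ℕₚ.m+[n∸m]≡n n<r)

  Den·n!·k!≡r! : Den ℕ.* (n ! ℕ.* k !) ≡ r !
  Den·n!·k!≡r! = subst (λ m → m ℕ.* ((m ℕ.∸ 1) C n) ℕ.* (n ! ℕ.* k !) ≡ m !) (trans (sym (ℕₚ.+-suc n k)) n+k+1≡r)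
    (trans (ℕₚ.*-assoc (suc (n ℕ.+ k)) ((n ℕ.+ k) C n) (n ! ℕ.* k !))
           (cong (suc (n ℕ.+ k) ℕ.*_) (subst (λ m → (m C n) ℕ.* (n ! ℕ.* k !) ≡ m !) (ℕₚ.+-comm k n) (binomial-factorials′ k n))))

  P = + (p ℕ.^ 3)
  n! k! r! S : ℤ
  n! = + (n !)
  k! = + (k !)
  r! = + (r !)
  S = sgnℤ (r ℕ.∸ n ℕ.+ 1)

  S≡ : S ≡ sgnℤ k
  S≡ = trans (cong (λ m → sgnℤ (m ℕ.+ 1)) (trans (cong (ℕ._∸ n) (sym n+k+1≡r)) (ℕₚ.m+n∸m≡n n (suc k))))
             (trans (cong (λ m → - sgnℤ m) (ℕₚ.+-comm k 1)) (ℤₚ.neg-involutive (sgnℤ k)))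

  rhs≐ : RHS ≐ S * + d * P * (n! * k!) ÷ + (r !)
  rhs≐ = ÷-cross (÷-rhs-b (÷-sgn (r ℕ.∸ n ℕ.+ 1)) (÷-÷ℕ d (p∤⇒pos p∤Den)) (÷-ℕ (p ℕ.^ 3)))
                 (trans (cong (S * + d * P *_) (trans (cong +_ (sym Den·n!·k!≡r!)) (ℤₚ.pos-* Den (n ! ℕ.* k !))))
                        (trans (regroup (S * + d * P) (+ Den) (+ (n ! ℕ.* k !))) (cong (λ u → S * + d * P * u * + Den) (ℤₚ.pos-* (n !) (k !)))))
                 (p∤⇒pos (p∤! r<p))
    where
    regroup : ∀ x D F → x * (D * F) ≡ x * F * D
    regroup = solve-∀
    p∤Den : ¬ p ∣ Den
    p∤Den p∣Den = p∤! r<p (subst (p ∣_) Den·n!·k!≡r! (∣-trans p∣Den (divides (n ! ℕ.* k !) (ℕₚ.*-comm Den _))))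

  partB-d≡0 : d ≡ 0 → CongModPow p 5 LHS RHS
  partB-d≡0 d≡0 = congModPow-÷ {k = 5} (÷-÷ℕ A (C-pos R≤N)) rhs≐ p∤denominators
    (mod-reflexive (trans (cong (λ a → + a * r!) A≡0)
                    (trans (annihilate r! S P (n! * k!) (+ (N C R))) (cong (λ x → S * + x * P * (n! * k!) * + (N C R)) (sym d≡0)))))
    where
    N≡R : N ≡ R
    N≡R = trans (sym d+R≡N) (cong (ℕ._+ R) d≡0)
    A≡0 : A ≡ 0
    A≡0 = k>n⇒nCk≡0 (subst (λ m → m ℕ.* p ℕ.^ 3 ℕ.+ n < R ℕ.* p ℕ.^ 3 ℕ.+ r) (sym N≡R) (ℕₚ.+-monoʳ-< (R ℕ.* p ℕ.^ 3) n<r))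
    annihilate : ∀ a s P f C → + 0 * a ≡ s * + 0 * P * f * C
    annihilate = solve-∀
    p∤denominators : ¬ p ∣ ∣ + (N C R) * + (r !) ∣
    p∤denominators = subst (λ m → ¬ p ∣ ∣ + (m C R) * + (r !) ∣) (sym N≡R)
      (subst (λ m → ¬ p ∣ ∣ + m * + (r !) ∣) (sym (nCn≡1 R)) (subst (λ m → ¬ p ∣ ∣ m ∣) (sym (ℤₚ.*-identityˡ (+ (r !)))) (p∤! r<p)))

  module _ (0<d : 0 < d) where
    k+1≤c : suc k ≤ c
    k+1≤c = ℕₚ.≤-trans (subst (suc k ≤_) n+k+1≡r (ℕₚ.m≤n+m (suc k) n))
              (ℕₚ.≤-trans (ℕₚ.<⇒≤ r<p) (ℕₚ.≤-trans (ℕₚ.m≤n*m p d {{ℕ.>-nonZero 0<d}})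
                (ℕₚ.≤-trans (ℕₚ.m≤m*n (d ℕ.* p) p) (ℕₚ.m≤m*n (d ℕ.* p ℕ.* p) p))))

    c′ = c ℕ.∸ suc k

    c′+k+1≡c : c′ ℕ.+ suc k ≡ c
    c′+k+1≡c = ℕₚ.m∸n+n≡m k+1≤c

    Pa = risingℕ (c ℕ.+ b) n
    Pb = risingℕ b r
    Q = risingℕ c′ (suc k)

    binomial-identity : A ℕ.* (Pb ℕ.* Φ₃ R) ≡ (N C R) ℕ.* (Ψ₃ d R ℕ.* Pa ℕ.* Q)
    binomial-identity = begin
        A ℕ.* (Pb ℕ.* Φ₃ R)
      ≡⟨ cong (λ u → u ℕ.* (Pb ℕ.* Φ₃ R)) (cong₂ _C_ top≡ bottom≡) ⟩
        A′ ℕ.* (Pb ℕ.* Φ₃ R)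
      ≡⟨ sym (ℕₚ.*-assoc A′ Pb (Φ₃ R)) ⟩
        A′ ℕ.* Pb ℕ.* Φ₃ R
      ≡⟨ cong (ℕ._* Φ₃ R) overshoot ⟩
        ((c ℕ.+ b) C b) ℕ.* Pa ℕ.* Q ℕ.* Φ₃ R
      ≡⟨ regroup₁ ((c ℕ.+ b) C b) Pa Q (Φ₃ R) ⟩
        ((c ℕ.+ b) C b) ℕ.* Φ₃ R ℕ.* Pa ℕ.* Q
      ≡⟨ cong (λ u → u ℕ.* Pa ℕ.* Q) (binomial-p³-blocks d R) ⟩
        ((d ℕ.+ R) C R) ℕ.* Ψ₃ d R ℕ.* Pa ℕ.* Q
      ≡⟨ cong (λ m → (m C R) ℕ.* Ψ₃ d R ℕ.* Pa ℕ.* Q) d+R≡N ⟩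
        (N C R) ℕ.* Ψ₃ d R ℕ.* Pa ℕ.* Q
      ≡⟨ regroup₂ (N C R) (Ψ₃ d R) Pa Q ⟩
        (N C R) ℕ.* (Ψ₃ d R ℕ.* Pa ℕ.* Q) ∎
      where
      open ≡-Reasoning
      A′ = (c ℕ.+ b ℕ.+ n) C (b ℕ.+ r)
      top≡ : N ℕ.* p ℕ.^ 3 ℕ.+ n ≡ c ℕ.+ b ℕ.+ n
      top≡ = trans (cong (λ u → u ℕ.* p ℕ.^ 3 ℕ.+ n) (sym d+R≡N)) (expand d R p n)
        where
        expand : ∀ d R p n → (d ℕ.+ R) ℕ.* (p ℕ.* (p ℕ.* (p ℕ.* 1))) ℕ.+ n ≡ d ℕ.* p ℕ.* p ℕ.* p ℕ.+ R ℕ.* p ℕ.* p ℕ.* p ℕ.+ n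
        expand = ℕ-Solver.solve-∀
      bottom≡ : R ℕ.* p ℕ.^ 3 ℕ.+ r ≡ b ℕ.+ r
      bottom≡ = expand R p r
        where
        expand : ∀ R p r → R ℕ.* (p ℕ.* (p ℕ.* (p ℕ.* 1))) ℕ.+ r ≡ R ℕ.* p ℕ.* p ℕ.* p ℕ.+ r
        expand = ℕ-Solver.solve-∀
      overshoot : A′ ℕ.* Pb ≡ ((c ℕ.+ b) C b) ℕ.* Pa ℕ.* Q
      overshoot = subst₂ (λ x y → ((x ℕ.+ b ℕ.+ n) C (b ℕ.+ y)) ℕ.* risingℕ b y ≡ ((x ℕ.+ b) C b) ℕ.* risingℕ (x ℕ.+ b) n ℕ.* Q)
                         c′+k+1≡c n+k+1≡r (binomial-rising-overshoot c′ k b n)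
      regroup₁ : ∀ x a q v → x ℕ.* a ℕ.* q ℕ.* v ≡ x ℕ.* v ℕ.* a ℕ.* q
      regroup₁ = ℕ-Solver.solve-∀
      regroup₂ : ∀ x u a q → x ℕ.* u ℕ.* a ℕ.* q ≡ x ℕ.* (u ℕ.* a ℕ.* q)
      regroup₂ = ℕ-Solver.solve-∀

    V U Q₁ : ℤ
    V = + Φ₃ R
    U = + Ψ₃ d R
    Q₁ = rising (+ c′) k * + d

    -- The last factor of Q is c′ + k + 1 = c = d p³.
    Q≡ : + Q ≡ P³ * Q₁
    Q≡ = trans (pos-rising c′ (suc k))
           (trans (cong (rising (+ c′) k *_) (trans (sym (ℤₚ.pos-+ c′ (suc k))) (trans (cong +_ c′+k+1≡c) (pos-p³ d))))
                  (rotate (rising (+ c′) k) P³ (+ d)))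
      where
      rotate : ∀ a P d → a * (P * d) ≡ P * (a * d)
      rotate = solve-∀

    mod-P³ : ∀ {x y} → x ≡ y mod π⁵ → x ≡ y mod P³
    mod-P³ = mod-divisor (π * π) (trans π⁵-unfold (split π))
      where
      split : ∀ x → x * x * x * x * x ≡ x * x * x * (x * x)
      split = solve-∀

    drop-P³ : ∀ {x} a y → x ≡ a + P³ * y mod π⁵ → x ≡ a mod P³
    drop-P³ a y x≡ = mod-trans (mod-P³ x≡) (y , cong (λ u → a + u) (ℤₚ.*-comm P³ y))

    Q₁-mod : Q₁ ≡ sgnℤ k * k! * + d mod P³
    Q₁-mod = mod-*ʳ (+ d) (mod-trans (rising-mod k c′≡) (mod-reflexive (trans (rising-reflect 0ℤ k) (cong (sgnℤ k *_) (rising-0 k)))))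
      where
      c′≡ : + c′ ≡ - (0ℤ + + suc k) mod P³
      c′≡ = + d , trans (isolate (+ c′) (+ suc k))
                        (trans (cong (λ u → u + - + suc k) (trans (sym (ℤₚ.pos-+ c′ (suc k))) (trans (cong +_ c′+k+1≡c) (pos-p³ d))))
                               (rearrange P³ (+ d) (+ suc k)))
        where
        isolate : ∀ x s → x ≡ (x + s) + - s
        isolate = solve-∀
        rearrange : ∀ P d s → P * d + - s ≡ - (0ℤ + s) + d * P
        rearrange = solve-∀

    core-P³ : U * + Pa * Q₁ * r! ≡ + Pb * V * n! * k! * (sgnℤ k * + d) mod P³
    core-P³ = begin
        U * + Pa * Q₁ * r!
      ≈⟨ mod-*ʳ r! (mod-* (mod-* U≡V Pa≡n!) Q₁-mod) ⟩
        V * n! * (sgnℤ k * k! * + d) * r!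
      ≡⟨ regroup V n! (sgnℤ k) k! (+ d) r! ⟩
        r! * V * n! * k! * (sgnℤ k * + d)
      ≈⟨ mod-*ʳ (sgnℤ k * + d) (mod-*ʳ k! (mod-*ʳ n! (mod-*ʳ V (mod-sym Pb≡r!)))) ⟩
        + Pb * V * n! * k! * (sgnℤ k * + d) ∎
      where
      open mod-Reasoning P³
      e₀ = + d * + R * (+ d + + R)
      expand : ∀ V w π e → V * (1ℤ + w * (π * π * π) * e) ≡ V + π * π * π * (V * w * e)
      expand = solve-∀
      U≡V : U ≡ V mod P³
      U≡V = drop-P³ V (V * + w * e₀) (mod-trans (Ψ₃-mod-π⁵ d R) (mod-reflexive (expand V (+ w) π e₀)))
      Pa≡n! : + Pa ≡ n! mod P³
      Pa≡n! = drop-P³ n! ((+ d + + R) * harmonicNumerator n) (rising-p³-sum d R n)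
      Pb≡r! : + Pb ≡ r! mod P³
      Pb≡r! = drop-P³ r! (+ R * harmonicNumerator r) (rising-p³ℕ R r)
      regroup : ∀ V f s g d r → V * f * (s * g * d) * r ≡ r * V * f * g * (s * d)
      regroup = solve-∀

    core : U * + Pa * + Q * r! ≡ + Pb * V * n! * k! * (sgnℤ k * + d * P³) mod π⁵
    core = begin
        U * + Pa * + Q * r!
      ≡⟨ trans (cong (λ u → U * + Pa * u * r!) Q≡) (pull U (+ Pa) P³ Q₁ r!) ⟩
        P³ * (U * + Pa * Q₁ * r!)
      ≈⟨ mod-divisor π (sym (trans (cong (_* π) π⁵-unfold) (square π))) (mod-scale P³ core-P³) ⟩
        P³ * (+ Pb * V * n! * k! * (sgnℤ k * + d))
      ≡⟨ push P³ (+ Pb * V * n! * k!) (sgnℤ k) (+ d) ⟩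
        + Pb * V * n! * k! * (sgnℤ k * + d * P³) ∎
      where
      open mod-Reasoning π⁵
      pull : ∀ U A P Q r → U * A * (P * Q) * r ≡ P * (U * A * Q * r)
      pull = solve-∀
      square : ∀ x → x * x * x * x * x * x ≡ x * x * x * (x * x * x)
      square = solve-∀
      push : ∀ P X s d → P * (X * (s * d)) ≡ X * (s * d * P)
      push = solve-∀

    G = Pb ℕ.* Φ₃ R

    p∤G : ¬ p ∣ G
    p∤G = p∤* (p∤rising r (p∣p³ R) r<p) (p∤Φ₃ R)

    lhs≐ : LHS ≐ + (Ψ₃ d R ℕ.* Pa ℕ.* Q) ÷ + G
    lhs≐ = ÷-cross (÷-÷ℕ A (C-pos R≤N))
                   (trans (sym (ℤₚ.pos-* A G)) (trans (cong +_ (trans binomial-identity (ℕₚ.*-comm (N C R) _)))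
                                                      (ℤₚ.pos-* (Ψ₃ d R ℕ.* Pa ℕ.* Q) (N C R))))
                   (p∤⇒pos p∤G)

    partB-d>0 : CongModPow p 5 LHS RHS
    partB-d>0 = congModPow-÷ {k = 5} lhs≐ rhs≐ p∤denominators (begin
        + (Ψ₃ d R ℕ.* Pa ℕ.* Q) * r!
      ≡⟨ cong (_* r!) (trans (ℤₚ.pos-* (Ψ₃ d R ℕ.* Pa) Q) (cong (_* + Q) (ℤₚ.pos-* (Ψ₃ d R) Pa))) ⟩
        U * + Pa * + Q * r!
      ≈⟨ core ⟩
        + Pb * V * n! * k! * (sgnℤ k * + d * P³)
      ≡⟨ cong₂ (λ s P → + Pb * V * n! * k! * (s * + d * P)) (sym S≡) (sym pos-p^3) ⟩
        + Pb * V * n! * k! * (S * + d * P)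
      ≡⟨ regroup (+ Pb) V n! k! (S * + d * P) ⟩
        S * + d * P * (n! * k!) * (+ Pb * V)
      ≡⟨ cong (S * + d * P * (n! * k!) *_) (sym (ℤₚ.pos-* Pb (Φ₃ R))) ⟩
        S * + d * P * (n! * k!) * + G ∎)
      where
      open mod-Reasoning π⁵
      regroup : ∀ B V f g x → B * V * f * g * x ≡ x * (f * g) * (B * V)
      regroup = solve-∀
      p∤denominators : ¬ p ∣ ∣ + G * + (r !) ∣
      p∤denominators = subst (λ m → ¬ p ∣ ∣ m ∣) (ℤₚ.pos-* G (r !)) (p∤* p∤G (p∤! r<p))

  partB : CongModPow p 5 LHS RHS
  partB with d ℕₚ.≟ 0
  ... | yes d≡0 = partB-d≡0 d≡0
  ... | no  d≢0 = partB-d>0 (ℕₚ.n≢0⇒n>0 d≢0)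

open import Data.Nat using (_^_; _∸_; _*_; _+_)
open import Data.Rational using () renaming (_+_ to _+ℚ_; _-_ to _-ℚ_; _*_ to _*ℚ_)

theorem3p5 : (p N R n r : ℕ) → Prime p → 7 ≤ p → R ≤ N → n < p → r < p →
    (w : ℕ) → w < p ^ 2 → CongModPow p 2 (H1 (p ∸ 1) *ℚ (1 ÷ℕ (p ^ 2))) (ℕtoℚ w) →
    (r ≤ n →
      CongModPow p 5
        (((N * p ^ 3 + n) C (R * p ^ 3 + r)) ÷ℕ ((N C R) * (n C r)))
        (ℕtoℚ 1 +ℚ (((H1 n *ℚ ℕtoℚ N) -ℚ (H1 r *ℚ ℕtoℚ R))
                 +ℚ (((ℕtoℚ w *ℚ ℕtoℚ N) *ℚ ℕtoℚ R) -ℚ H1 (n ∸ r)) *ℚ ℕtoℚ (N ∸ R))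
               *ℚ ℕtoℚ (p ^ 3)))
    × (n < r →
      CongModPow p 5
        (((N * p ^ 3 + n) C (R * p ^ 3 + r)) ÷ℕ (N C R))
        ((sgn (r ∸ n + 1) *ℚ ((N ∸ R) ÷ℕ (r * ((r ∸ 1) C n)))) *ℚ ℕtoℚ (p ^ 3)))
theorem3p5 (suc q) N R n r p-prime (s≤s 6≤q) R≤N n<p r<p w _ H1≡w =
    (λ r≤n → PartA.partA p-prime 6≤q w H1≡w N R n r R≤N r≤n n<p)
  , (λ n<r → PartB.partB p-prime 6≤q w H1≡w N R n r R≤N n<r r<p)
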